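{- Let $\gamma\approx 1.325$ be the unique real solution of $1+\gamma=\gamma^3$. Let $G$ be a triangle-free graph with a fixed order $\prec$ on $V(G)$, and let $I$ be a maximal independent set of $G$. Then $\mathrm{mis}(R(I))\le(3\gamma)^{r(I)/4}$.
   Context: $\mathrm{mis}(H)$ is the number of maximal independent sets of $H$. $N(x)$ is the neighborhood of $x$ and $d_S(x)=|N(x)\cap S|$. Run the following process: set $X_0=V(G)$ and for $i=1,2,\ldots$: (1) let $x_i$ be the $\prec$-first vertex of $X_{i-1}$ among those maximizing $d_{X_{i-1}}(\cdot)$ over $X_{i-1}$; (2) if $x_i\in I$ set $X_i=X_{i-1}\setminus(\{x_i\}\cup N(x_i))$, otherwise set $X_i=X_{i-1}\setminus\{x_i\}$; (3) terminate if $d_{X_i}(x)\le 2$ for all $x\in X_i$. Let $X^*$ be the final set and $G^*=G[X^*]$. An edge $vw$ of $G^*$ is isolated if $G^*[\{v,w\}]$ is a connected component of $G^*$; let $V(M)$ be the set of endpoints of isolated edges of $G^*$, $R(I)=G^*[X^*\setminus V(M)]$, and $r(I)=|V(R(I))|$. -}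

module Defs where

open import Data.Bool.Base using (Bool; true; false; _∧_; _∨_; not; if_then_else_; T)
open import Data.Nat.Base using (ℕ; zero; suc; _+_; _≡ᵇ_; _≤ᵇ_; _⊔_)
open import Data.Fin.Base using (Fin)
open import Data.Fin.Permutation using (Permutation′; _⟨$⟩ˡ_)
open import Data.List.Base using (List; []; _∷_; map; filter; length; allFin; findᵇ; foldr)
open import Data.Bool.ListAction using (any; all)
open import Data.Fin.Properties using () renaming (_≟_ to _≟F_)
open import Relation.Nullary.Decidable.Core using (T?; does)
open import Data.Empty using (⊥)
open import Data.Maybe.Base using (Maybe; just; nothing)
open import Data.Vec.Base using (Vec; []; _∷_)
open import Data.Rational.Base using (ℚ; 1ℚ; _*_)
open import Relation.Binary.PropositionalEquality using (_≡_)
open import Relation.Nullary using (¬_)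
open import Data.Product.Base using (_×_)

record Graph (n : ℕ) : Set where
  field
    adj   : Fin n → Fin n → Bool
    sym   : ∀ u v → adj u v ≡ adj v u
    loopless : ∀ v → adj v v ≡ false
open Graph public

VSet : ℕ → Set
VSet n = Fin n → Bool

TriangleFree : ∀ {n} → Graph n → Set
TriangleFree G = ∀ u v w → T (adj G u v) → T (adj G v w) → T (adj G u w) → ⊥

card : ∀ {n} → VSet n → ℕ
card {n} S = length (filter (λ v → T? (S v)) (allFin n))

deg : ∀ {n} → Graph n → VSet n → Fin n → ℕ
deg G S x = card (λ y → S y ∧ adj G x y)

independentᵇ : ∀ {n} → Graph n → VSet n → VSet n → Bool
independentᵇ {n} G S I =
  all (λ u → all (λ v → not (I u ∧ I v ∧ adj G u v)) (allFin n)) (allFin n)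
  ∧ all (λ u → not (I u) ∨ S u) (allFin n)

maximalIndependentᵇ : ∀ {n} → Graph n → VSet n → VSet n → Bool
maximalIndependentᵇ {n} G S I =
  independentᵇ G S I
  ∧ all (λ v → not (S v) ∨ I v ∨ any (λ u → I u ∧ adj G u v) (allFin n)) (allFin n)

MaximalIndependent : ∀ {n} → Graph n → VSet n → Set
MaximalIndependent G I = T (maximalIndependentᵇ G (λ _ → true) I)

allSubsets : ∀ n → List (VSet n)
allSubsets zero = (λ ()) ∷ []
allSubsets (suc n) =
  foldr (λ S acc → ext false S ∷ ext true S ∷ acc) [] (allSubsets n)
  where
    ext : Bool → VSet n → VSet (suc n)
    ext b S Fin.zero = b
    ext b S (Fin.suc i) = S i

misInduced : ∀ {n} → Graph n → VSet n → ℕ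
misInduced {n} G S = length (filter (λ I → T? (maximalIndependentᵇ G S I)) (allSubsets n))

maxDeg≤2ᵇ : ∀ {n} → Graph n → VSet n → Bool
maxDeg≤2ᵇ {n} G X = all (λ x → not (X x) ∨ (deg G X x ≤ᵇ 2)) (allFin n)

maxDeg : ∀ {n} → Graph n → VSet n → ℕ
maxDeg {n} G X = foldr (λ x m → if X x then deg G X x ⊔ m else m) 0 (allFin n)

-- the ≺-first vertex of X maximising d_X; the order ≺ is given by a
-- permutation π : positions p ↦ vertex π ⟨$⟩ˡ p  (u ≺ v iff pos u < pos v)
chooseVertex : ∀ {n} → Permutation′ n → Graph n → VSet n → Maybe (Fin n)
chooseVertex {n} π G X =
  findᵇ (λ x → X x ∧ (deg G X x ≡ᵇ maxDeg G X)) (map (π ⟨$⟩ˡ_) (allFin n))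

step : ∀ {n} → Permutation′ n → Graph n → VSet n → VSet n → VSet n
step π G I X with chooseVertex π G X
... | nothing = X
... | just x  = λ y → X y ∧ not (x ≟ᵇ y) ∧ not (I x ∧ adj G x y)
  where
    _≟ᵇ_ : Fin _ → Fin _ → Bool
    a ≟ᵇ b = does (a ≟F b)

-- iterate with fuel; each non-terminal step removes a vertex, so fuel n suffices
run : ∀ {n} → ℕ → Permutation′ n → Graph n → VSet n → VSet n → VSet n
run zero π G I X = X
run (suc k) π G I X = if maxDeg≤2ᵇ G X then X else run k π G I (step π G I X)

Xstar : ∀ {n} → Permutation′ n → Graph n → VSet n → VSet n
Xstar {n} π G I = run n π G I (λ _ → true)

-- V(M): endpoints of isolated edges of G* = G[X*]
VM : ∀ {n} → Permutation′ n → Graph n → VSet n → VSet n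
VM {n} π G I v =
  X v ∧ any (λ w → X w ∧ adj G v w ∧ (deg G X v ≡ᵇ 1) ∧ (deg G X w ≡ᵇ 1)) (allFin n)
  where X = Xstar π G I

VR : ∀ {n} → Permutation′ n → Graph n → VSet n → VSet n
VR π G I v = Xstar π G I v ∧ not (VM π G I v)

r : ∀ {n} → Permutation′ n → Graph n → VSet n → ℕ
r π G I = card (VR π G I)

misR : ∀ {n} → Permutation′ n → Graph n → VSet n → ℕ
misR π G I = misInduced G (VR π G I)

_^ℚ_ : ℚ → ℕ → ℚ
q ^ℚ zero = 1ℚ
q ^ℚ suc k = q * (q ^ℚ k)

module Submission where

-- mis(R(I)) ≤ (3γ)^(r(I)/4) is proved in the form mis(R)⁴ ≤ (3q)^r for every rational q
-- with q³ > q + 1.  Every such q is at least κ = 1.3247, so it suffices to prove the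
-- natural-number inequality mis(R)⁴ · 10000^r ≤ 39741^r, since 3κ = 3.9741; the module
-- Rational pins down κ and performs this transfer.
--
-- The process stops only when G* = G[X*] has maximum degree at most 2, so R = R(I) has
-- maximum degree at most 2, and since the isolated edges of G* were removed, every
-- degree-1 vertex of R hangs on a degree-2 vertex: #(degree 1) ≤ 2 · #(degree 2).
-- The core is a measure bound for a triangle-free G and S ⊆ V(G) with G[S] of maximum
-- degree at most 2:   mis(G[S]) ≤ ∏_{v ∈ S} w(d_S(v)),  w(0) = 1, w(1) = 1.4143, w(2) = 1.406,
-- proved by induction on |S|: every maximal independent set meets N[v] for a vertex v of
-- minimum degree, and deleting the closed neighbourhood of the chosen vertex costs its
-- weights while raising the weights of the boundary by at most 1.4143 / 1.406 each.
-- Weights are scaled by 10⁴ so that everything stays in ℕ.  With the degree count above,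
-- 1.4143⁴ ≤ 3.9741 and 1.4143⁸ · 1.406⁴ ≤ 3.9741³ then give the natural-number bound.

open import Defs hiding (sym)

module Rational where
  open import Data.Nat.Base as ℕ using (ℕ; zero; suc)
  open import Data.Integer.Base as ℤ using (+_)
  import Data.Integer.Properties as ℤₚ
  open import Data.Rational.Base
  open import Data.Rational.Properties
  open import Data.Rational.Solver using (module +-*-Solver)
  open import Data.Nat.Coprimality using (1-coprimeTo) renaming (sym to coprime-sym)
  open import Data.Sum.Base using (inj₁; inj₂)
  open import Relation.Binary.PropositionalEquality
  open import Relation.Nullary.Decidable using (toWitness)
  open +-*-Solver

  ι : ℕ → ℚ
  ι a = + a / 1

  ι-normal : ∀ a → ι a ≡ mkℚ (+ a) 0 (coprime-sym (1-coprimeTo a))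
  ι-normal a = ↥p/↧p≡p (mkℚ (+ a) 0 (coprime-sym (1-coprimeTo a)))

  ι-mono : ∀ {a b} → a ℕ.≤ b → ι a ≤ ι b
  ι-mono {a} {b} a≤b rewrite ι-normal a | ι-normal b =
    *≤* (subst₂ ℤ._≤_ (sym (ℤₚ.*-identityʳ (+ a))) (sym (ℤₚ.*-identityʳ (+ b))) (ℤ.+≤+ a≤b))

  ι-* : ∀ a b → ι (a ℕ.* b) ≡ ι a * ι b
  ι-* a b = trans (cong (_/ 1) (ℤₚ.pos-* a b)) (sym (cong₂ _*_ (ι-normal a) (ι-normal b)))

  ι-^ : ∀ a k → ι (a ℕ.^ k) ≡ ι a ^ℚ k
  ι-^ a zero = refl
  ι-^ a (suc k) = trans (ι-* a (a ℕ.^ k)) (cong (ι a *_) (ι-^ a k))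

  ^ℚ-distrib-* : ∀ x y k → (x * y) ^ℚ k ≡ x ^ℚ k * y ^ℚ k
  ^ℚ-distrib-* x y zero = refl
  ^ℚ-distrib-* x y (suc k) = trans (cong (x * y *_) (^ℚ-distrib-* x y k)) (regroup x y (x ^ℚ k) (y ^ℚ k))
    where
    regroup : ∀ a b c d → a * b * (c * d) ≡ a * c * (b * d)
    regroup = solve 4 (λ a b c d → a :* b :* (c :* d) := a :* c :* (b :* d)) refl

  ^ℚ-nonneg : ∀ x k → 0ℚ ≤ x → 0ℚ ≤ x ^ℚ k
  ^ℚ-nonneg x zero _ = toWitness {a? = 0ℚ ≤? 1ℚ} _
  ^ℚ-nonneg x (suc k) 0≤x =
    nonNegative⁻¹ _ {{nonNeg*nonNeg⇒nonNeg x {{nonNegative 0≤x}} (x ^ℚ k) {{nonNegative (^ℚ-nonneg x k 0≤x)}}}}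

  ^ℚ-positive : ∀ x k → 0ℚ < x → 0ℚ < x ^ℚ k
  ^ℚ-positive x zero _ = toWitness {a? = 0ℚ <? 1ℚ} _
  ^ℚ-positive x (suc k) 0<x =
    positive⁻¹ _ {{pos*pos⇒pos x {{positive 0<x}} (x ^ℚ k) {{positive (^ℚ-positive x k 0<x)}}}}

  ^ℚ-mono : ∀ x y k → 0ℚ ≤ x → x ≤ y → x ^ℚ k ≤ y ^ℚ k
  ^ℚ-mono x y zero _ _ = ≤-refl
  ^ℚ-mono x y (suc k) 0≤x x≤y =
    ≤-trans (*-monoʳ-≤-nonNeg (x ^ℚ k) {{nonNegative (^ℚ-nonneg x k 0≤x)}} x≤y)
            (*-monoˡ-≤-nonNeg y {{nonNegative (≤-trans 0≤x x≤y)}} (^ℚ-mono x y k 0≤x x≤y))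

  -- κ = 1.3247 lies below γ: with b = (3/4)κ² - 1 ≥ 0 and c = κ³ - κ - 1 < 0,
  -- q³ - q - 1 = (q - κ)((q + κ/2)² + b) + c is negative for q < κ.

  κ half-κ b c : ℚ
  κ = + 13247 / 10000
  half-κ = + 13247 / 20000
  b = κ * κ - half-κ * half-κ - 1ℚ
  c = κ * κ * κ - κ - 1ℚ

  cubic-expansion : ∀ q → q ^ℚ 3 ≡ (q + 1ℚ) + ((q - κ) * ((q + half-κ) * (q + half-κ) + b) + c)
  cubic-expansion = solve 1 (λ q →
    q :* (q :* (q :* con 1ℚ)) := (q :+ con 1ℚ) :+ ((q :- con κ) :* ((q :+ con half-κ) :* (q :+ con half-κ) :+ con b) :+ con c)) refl

  square-nonneg : ∀ x → 0ℚ ≤ x * x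
  square-nonneg x with ≤-total 0ℚ x
  ... | inj₁ 0≤x = nonNegative⁻¹ (x * x) {{nonNeg*nonNeg⇒nonNeg x {{nonNegative 0≤x}} x {{nonNegative 0≤x}}}}
  ... | inj₂ x≤0 = nonNegative⁻¹ (x * x) {{nonPos*nonPos⇒nonPos x {{nonPositive x≤0}} x {{nonPositive x≤0}}}}

  below-κ : ∀ q → q < κ → q ^ℚ 3 < q + 1ℚ
  below-κ q q<κ = subst (_< q + 1ℚ) (sym (cubic-expansion q))
    (subst ((q + 1ℚ) + ((q - κ) * quadratic + c) <_) (+-identityʳ (q + 1ℚ)) (+-monoʳ-< (q + 1ℚ) remainder-negative))
    where
    quadratic : ℚ
    quadratic = (q + half-κ) * (q + half-κ) + b
    quadratic-nonneg : 0ℚ ≤ quadratic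
    quadratic-nonneg = +-mono-≤ (square-nonneg (q + half-κ)) (toWitness {a? = 0ℚ ≤? b} _)
    q-κ<0 : q - κ < 0ℚ
    q-κ<0 = subst (q - κ <_) (+-inverseʳ κ) (+-monoˡ-< (- κ) q<κ)
    product-nonpos : (q - κ) * quadratic ≤ 0ℚ
    product-nonpos = nonPositive⁻¹ _ {{nonPos*nonNeg⇒nonPos (q - κ) {{nonPositive (<⇒≤ q-κ<0)}} quadratic {{nonNegative quadratic-nonneg}}}}
    remainder-negative : (q - κ) * quadratic + c < 0ℚ
    remainder-negative = +-mono-≤-< product-nonpos (toWitness {a? = c <? 0ℚ} _)

  κ≤ : ∀ q → q + 1ℚ < q ^ℚ 3 → κ ≤ q
  κ≤ q q+1<q³ = ≮⇒≥ (λ q<κ → <-asym q+1<q³ (below-κ q q<κ))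

  rational-bound : ∀ x r q → x ℕ.^ 4 ℕ.* 10000 ℕ.^ r ℕ.≤ 39741 ℕ.^ r → q + 1ℚ < q ^ℚ 3 →
    ι x ^ℚ 4 ≤ (ι 3 * q) ^ℚ r
  rational-bound x r q bound q+1<q³ = *-cancelʳ-≤-pos W {{positive W-positive}} (begin
    ι x ^ℚ 4 * W                         ≡⟨ cong₂ _*_ (ι-^ x 4) (ι-^ 10000 r) ⟨
    ι (x ℕ.^ 4) * ι (10000 ℕ.^ r)        ≡⟨ ι-* (x ℕ.^ 4) (10000 ℕ.^ r) ⟨
    ι (x ℕ.^ 4 ℕ.* 10000 ℕ.^ r)          ≤⟨ ι-mono bound ⟩
    ι (39741 ℕ.^ r)                      ≡⟨ ι-^ 39741 r ⟩
    ι 39741 ^ℚ r                         ≤⟨ ^ℚ-mono (ι 39741) _ r (toWitness {a? = 0ℚ ≤? ι 39741} _) base ⟩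
    ((ι 3 * q) * ι 10000) ^ℚ r           ≡⟨ ^ℚ-distrib-* (ι 3 * q) (ι 10000) r ⟩
    (ι 3 * q) ^ℚ r * W                   ∎)
    where
    open ≤-Reasoning
    W = ι 10000 ^ℚ r
    W-positive : 0ℚ < W
    W-positive = ^ℚ-positive (ι 10000) r (toWitness {a? = 0ℚ <? ι 10000} _)
    base : ι 39741 ≤ (ι 3 * q) * ι 10000
    base = ≤-trans (toWitness {a? = ι 39741 ≤? (ι 3 * κ) * ι 10000} _)
                   (*-monoʳ-≤-nonNeg (ι 10000) {{nonNegative (toWitness {a? = 0ℚ ≤? ι 10000} _)}}
                     (*-monoˡ-≤-nonNeg (ι 3) {{nonNegative (toWitness {a? = 0ℚ ≤? ι 3} _)}} (κ≤ q q+1<q³)))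

open import Data.Bool.Base using (Bool; true; false; _∧_; _∨_; not; if_then_else_; T)
open import Data.Bool.Properties using (∨-identityʳ)
open import Data.Bool.ListAction using (all; any)
open import Data.Nat.Base using (ℕ; zero; suc; _+_; _*_; _^_; _∸_; _≤_; _<_; z≤n; s≤s; _≤ᵇ_; _≡ᵇ_; _⊔_)
open import Data.Nat.Properties hiding (_≟_)
open import Data.Nat.Tactic.RingSolver using (solve-∀)
open import Data.Fin.Base using (Fin; zero; suc)
open import Data.Fin.Properties using (_≟_)
open import Data.Fin.Permutation using (Permutation′; _⟨$⟩ˡ_; _⟨$⟩ʳ_; inverseˡ)
open import Data.List.Base using (List; []; _∷_; filter; length; tabulate; foldr; map; findᵇ; allFin)
open import Data.List.Membership.Propositional using (_∈_)
open import Data.List.Membership.Propositional.Properties using (∈-map⁺; ∈-allFin)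
open import Data.List.Relation.Unary.Any using (here; there)
open import Data.Maybe.Base using (just; nothing)
open import Data.Product.Base using (Σ; _×_; _,_; proj₁; proj₂)
open import Data.Sum.Base using (_⊎_; inj₁; inj₂)
open import Data.Empty using (⊥; ⊥-elim)
open import Data.Unit.Base using (tt)
open import Relation.Nullary using (¬_; yes; no)
open import Relation.Nullary.Decidable using (dec-true; dec-false)
open import Relation.Nullary.Decidable.Core using (T?; does)
open import Relation.Binary.PropositionalEquality
open import Algebra.Properties.CommutativeSemigroup +-commutativeSemigroup
  using () renaming (interchange to +-interchange)
open import Algebra.Properties.CommutativeSemigroup *-commutativeSemigroup
  using () renaming (interchange to *-interchange; xy∙z≈xz∙y to *-right-comm)
import Data.Integer.Base as ℤ
import Data.Rational.Base as ℚ
open import Data.Rational.Base using (ℚ; 1ℚ)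
open Rational using (rational-bound)

∧-intro : ∀ {a b} → T a → T b → T (a ∧ b)
∧-intro {true} {true} _ _ = tt

∧-fst : ∀ {a b} → T (a ∧ b) → T a
∧-fst {true} _ = tt

∧-snd : ∀ {a b} → T (a ∧ b) → T b
∧-snd {true} t = t

∨-inl : ∀ {a b} → T a → T (a ∨ b)
∨-inl {true} _ = tt

∨-inr : ∀ {a b} → T b → T (a ∨ b)
∨-inr {true} _ = tt
∨-inr {false} t = t

∨-elim : ∀ {a b} → T (a ∨ b) → T a ⊎ T b
∨-elim {true} _ = inj₁ tt
∨-elim {false} t = inj₂ t

not-intro : ∀ {a} → ¬ T a → T (not a)
not-intro {false} _ = tt
not-intro {true} h = h tt

not-elim : ∀ {a} → T (not a) → ¬ T a
not-elim {false} _ ()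

⇒-intro : ∀ {a b} → (T a → T b) → T (not a ∨ b)
⇒-intro {true} h = h tt
⇒-intro {false} _ = tt

⇒-elim : ∀ {a b} → T (not a ∨ b) → T a → T b
⇒-elim {true} t _ = t

T-case : ∀ a → T a ⊎ T (not a)
T-case true = inj₁ tt
T-case false = inj₂ tt

T⇒≡true : ∀ {a} → T a → a ≡ true
T⇒≡true {true} _ = refl

¬T⇒≡false : ∀ {a} → ¬ T a → a ≡ false
¬T⇒≡false {false} _ = refl
¬T⇒≡false {true} h = ⊥-elim (h tt)

≡true⇒T : ∀ {a} → a ≡ true → T a
≡true⇒T refl = tt

T-ext : ∀ a b → (T a → T b) → (T b → T a) → a ≡ b
T-ext false false f g = refl
T-ext false true f g = ⊥-elim (g tt)
T-ext true false f g = ⊥-elim (f tt)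
T-ext true true f g = refl

all-tabulate : ∀ {A : Set} n (f : Fin n → A) (p : A → Bool) →
  T (all p (tabulate f)) → ∀ i → T (p (f i))
all-tabulate (suc n) f p t zero = ∧-fst t
all-tabulate (suc n) f p t (suc i) = all-tabulate n _ p (∧-snd {p (f zero)} t) i

tabulate-all : ∀ {A : Set} n (f : Fin n → A) (p : A → Bool) →
  (∀ i → T (p (f i))) → T (all p (tabulate f))
tabulate-all zero f p h = tt
tabulate-all (suc n) f p h = ∧-intro (h zero) (tabulate-all n _ p (λ i → h (suc i)))

any-tabulate : ∀ {A : Set} n (f : Fin n → A) (p : A → Bool) →
  T (any p (tabulate f)) → Σ (Fin n) λ i → T (p (f i))
any-tabulate (suc n) f p t with ∨-elim {p (f zero)} t
... | inj₁ t₀ = zero , t₀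
... | inj₂ t₁ with any-tabulate n _ p t₁
...   | i , ti = suc i , ti

tabulate-any : ∀ {A : Set} n (f : Fin n → A) (p : A → Bool) i →
  T (p (f i)) → T (any p (tabulate f))
tabulate-any (suc n) f p zero t = ∨-inl t
tabulate-any (suc n) f p (suc i) t = ∨-inr {p (f zero)} (tabulate-any n _ p i t)

all-elim : ∀ {n} (p : Fin n → Bool) → T (all p (allFin n)) → ∀ i → T (p i)
all-elim {n} p = all-tabulate n (λ i → i) p

all-intro : ∀ {n} (p : Fin n → Bool) → (∀ i → T (p i)) → T (all p (allFin n))
all-intro {n} p = tabulate-all n (λ i → i) p

any-elim : ∀ {n} (p : Fin n → Bool) → T (any p (allFin n)) → Σ (Fin n) λ i → T (p i)
any-elim {n} p = any-tabulate n (λ i → i) p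

any-intro : ∀ {n} (p : Fin n → Bool) i → T (p i) → T (any p (allFin n))
any-intro {n} p = tabulate-any n (λ i → i) p

indicator : Bool → ℕ
indicator true = 1
indicator false = 0

indicator-mono : ∀ a b → (T a → T b) → indicator a ≤ indicator b
indicator-mono false b h = z≤n
indicator-mono true true h = ≤-refl
indicator-mono true false h = ⊥-elim (h tt)

count : ∀ {A : Set} → (A → Bool) → List A → ℕ
count p xs = length (filter (λ x → T? (p x)) xs)

count-∷ : ∀ {A : Set} (p : A → Bool) x xs → count p (x ∷ xs) ≡ indicator (p x) + count p xs
count-∷ p x xs with p x
... | true = refl
... | false = refl

count-mono : ∀ {A : Set} (p q : A → Bool) xs →
  (∀ x → T (p x) → T (q x)) → count p xs ≤ count q xs
count-mono p q [] h = z≤n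
count-mono p q (x ∷ xs) h = begin
  count p (x ∷ xs)               ≡⟨ count-∷ p x xs ⟩
  indicator (p x) + count p xs   ≤⟨ +-mono-≤ (indicator-mono _ _ (h x)) (count-mono p q xs h) ⟩
  indicator (q x) + count q xs   ≡⟨ count-∷ q x xs ⟨
  count q (x ∷ xs)               ∎
  where open ≤-Reasoning

count-union : ∀ {A : Set} (p q r : A → Bool) xs →
  (∀ x → T (p x) → T (q x) ⊎ T (r x)) → count p xs ≤ count q xs + count r xs
count-union p q r [] h = z≤n
count-union p q r (x ∷ xs) h = begin
  count p (x ∷ xs)                                           ≡⟨ count-∷ p x xs ⟩
  indicator (p x) + count p xs                               ≤⟨ +-mono-≤ (head-bound (h x)) (count-union p q r xs h) ⟩
  (indicator (q x) + indicator (r x)) + (count q xs + count r xs)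
                                                             ≡⟨ +-interchange (indicator (q x)) _ _ _ ⟩
  (indicator (q x) + count q xs) + (indicator (r x) + count r xs)
                                                             ≡⟨ cong₂ _+_ (count-∷ q x xs) (count-∷ r x xs) ⟨
  count q (x ∷ xs) + count r (x ∷ xs)                        ∎
  where
  open ≤-Reasoning
  head-bound : (T (p x) → T (q x) ⊎ T (r x)) → indicator (p x) ≤ indicator (q x) + indicator (r x)
  head-bound hx with p x | q x | r x
  ... | false | _ | _ = z≤n
  ... | true | true | _ = s≤s z≤n
  ... | true | false | true = s≤s z≤n
  ... | true | false | false with hx tt
  ...   | inj₁ ()
  ...   | inj₂ ()

count-cong : ∀ {A : Set} (p q : A → Bool) xs → (∀ x → p x ≡ q x) → count p xs ≡ count q xs
count-cong p q xs h = ≤-antisym (count-mono p q xs (λ x → subst T (h x)))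
                                (count-mono q p xs (λ x → subst T (sym (h x))))

count-none : ∀ {A : Set} (p : A → Bool) xs → (∀ x → p x ≡ false) → count p xs ≡ 0
count-none p [] h = refl
count-none p (x ∷ xs) h = trans (count-∷ p x xs) (cong₂ _+_ (cong indicator (h x)) (count-none p xs h))

sumFin : ∀ n → (Fin n → ℕ) → ℕ
sumFin zero f = 0
sumFin (suc n) f = f zero + sumFin n (λ i → f (suc i))

prodFin : ∀ n → (Fin n → ℕ) → ℕ
prodFin zero f = 1
prodFin (suc n) f = f zero * prodFin n (λ i → f (suc i))

sumFin-cong : ∀ n (f g : Fin n → ℕ) → (∀ i → f i ≡ g i) → sumFin n f ≡ sumFin n g
sumFin-cong zero f g h = refl
sumFin-cong (suc n) f g h = cong₂ _+_ (h zero) (sumFin-cong n _ _ (λ i → h (suc i)))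

sumFin-mono : ∀ n (f g : Fin n → ℕ) → (∀ i → f i ≤ g i) → sumFin n f ≤ sumFin n g
sumFin-mono zero f g h = z≤n
sumFin-mono (suc n) f g h = +-mono-≤ (h zero) (sumFin-mono n _ _ (λ i → h (suc i)))

sumFin-+ : ∀ n (f g : Fin n → ℕ) → sumFin n (λ i → f i + g i) ≡ sumFin n f + sumFin n g
sumFin-+ zero f g = refl
sumFin-+ (suc n) f g =
  trans (cong (f zero + g zero +_) (sumFin-+ n _ _)) (+-interchange (f zero) (g zero) _ _)

sumFin-zero : ∀ n → sumFin n (λ _ → 0) ≡ 0
sumFin-zero zero = refl
sumFin-zero (suc n) = sumFin-zero n

sumFin-swap : ∀ n m (f : Fin n → Fin m → ℕ) →
  sumFin n (λ i → sumFin m (f i)) ≡ sumFin m (λ j → sumFin n (λ i → f i j))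
sumFin-swap zero m f = sym (sumFin-zero m)
sumFin-swap (suc n) m f =
  trans (cong (sumFin m (f zero) +_) (sumFin-swap n m (λ i → f (suc i))))
        (sym (sumFin-+ m (f zero) (λ j → sumFin n (λ i → f (suc i) j))))

sumFin-*ˡ : ∀ n c (f : Fin n → ℕ) → sumFin n (λ i → c * f i) ≡ c * sumFin n f
sumFin-*ˡ zero c f = sym (*-zeroʳ c)
sumFin-*ˡ (suc n) c f =
  trans (cong (c * f zero +_) (sumFin-*ˡ n c _)) (sym (*-distribˡ-+ c (f zero) _))

term≤sumFin : ∀ n (f : Fin n → ℕ) i → f i ≤ sumFin n f
term≤sumFin (suc n) f zero = m≤m+n _ _
term≤sumFin (suc n) f (suc i) = ≤-trans (term≤sumFin n _ i) (m≤n+m _ _)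

prodFin-cong : ∀ n (f g : Fin n → ℕ) → (∀ i → f i ≡ g i) → prodFin n f ≡ prodFin n g
prodFin-cong zero f g h = refl
prodFin-cong (suc n) f g h = cong₂ _*_ (h zero) (prodFin-cong n _ _ (λ i → h (suc i)))

prodFin-* : ∀ n (f g : Fin n → ℕ) → prodFin n (λ i → f i * g i) ≡ prodFin n f * prodFin n g
prodFin-* zero f g = refl
prodFin-* (suc n) f g =
  trans (cong (f zero * g zero *_) (prodFin-* n _ _)) (*-interchange (f zero) (g zero) _ _)

prodFin-positive : ∀ n (f : Fin n → ℕ) → (∀ i → 1 ≤ f i) → 1 ≤ prodFin n f
prodFin-positive zero f h = ≤-refl
prodFin-positive (suc n) f h = *-mono-≤ (h zero) (prodFin-positive n _ (λ i → h (suc i)))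

count-tabulate : ∀ {A : Set} n (f : Fin n → A) (p : A → Bool) →
  count p (tabulate f) ≡ sumFin n (λ i → indicator (p (f i)))
count-tabulate zero f p = refl
count-tabulate (suc n) f p =
  trans (count-∷ p (f zero) _) (cong (indicator (p (f zero)) +_) (count-tabulate n _ p))

_⊆_ : ∀ {n} → VSet n → VSet n → Set
X ⊆ Y = ∀ u → T (X u) → T (Y u)

_∩_ : ∀ {n} → VSet n → VSet n → VSet n
(X ∩ Y) u = X u ∧ Y u

_∖_ : ∀ {n} → VSet n → VSet n → VSet n
(X ∖ Y) u = X u ∧ not (Y u)

⁅_⁆ : ∀ {n} → Fin n → VSet n
⁅ x ⁆ u = does (u ≟ x)

∅ : ∀ {n} → VSet n
∅ _ = false

⁅⁆-self : ∀ {n} (x : Fin n) → T (⁅ x ⁆ x)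
⁅⁆-self x = ≡true⇒T (dec-true (x ≟ x) refl)

⁅⁆-elim : ∀ {n} {x u : Fin n} → T (⁅ x ⁆ u) → u ≡ x
⁅⁆-elim {x = x} {u} t with u ≟ x
... | yes e = e

⁅⁆-other : ∀ {n} {x u : Fin n} → ¬ (u ≡ x) → ⁅ x ⁆ u ≡ false
⁅⁆-other {x = x} {u} = dec-false (u ≟ x)

fin-case : ∀ {n} (x y : Fin n) → (x ≡ y) ⊎ ¬ (x ≡ y)
fin-case x y with x ≟ y
... | yes e = inj₁ e
... | no ne = inj₂ ne

∣_∣ : ∀ {n} → VSet n → ℕ
∣_∣ {n} X = sumFin n (λ i → indicator (X i))

card≡∣∣ : ∀ {n} (X : VSet n) → card X ≡ ∣ X ∣
card≡∣∣ {n} X = count-tabulate n (λ i → i) X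

∣∣≤n : ∀ {n} (X : VSet n) → ∣ X ∣ ≤ n
∣∣≤n {n} X = ≤-trans (sumFin-mono n _ (λ _ → 1) (λ i → indicator≤1 (X i))) (≤-reflexive (ones n))
  where
  indicator≤1 : ∀ b → indicator b ≤ 1
  indicator≤1 true = ≤-refl
  indicator≤1 false = z≤n
  ones : ∀ m → sumFin m (λ _ → 1) ≡ m
  ones zero = refl
  ones (suc m) = cong suc (ones m)

∣∣-mono : ∀ {n} {X Y : VSet n} → X ⊆ Y → ∣ X ∣ ≤ ∣ Y ∣
∣∣-mono {n} {X} {Y} h = sumFin-mono n _ _ (λ i → indicator-mono (X i) (Y i) (h i))

∣∣-cong : ∀ {n} {X Y : VSet n} → (∀ u → X u ≡ Y u) → ∣ X ∣ ≡ ∣ Y ∣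
∣∣-cong {n} h = sumFin-cong n _ _ (λ i → cong indicator (h i))

∣∣-split : ∀ {n} (X Y : VSet n) → ∣ X ∣ ≡ ∣ X ∩ Y ∣ + ∣ X ∖ Y ∣
∣∣-split {n} X Y = trans (sumFin-cong n _ _ pointwise) (sumFin-+ n _ _)
  where
  pointwise : ∀ i → indicator (X i) ≡ indicator (X i ∧ Y i) + indicator (X i ∧ not (Y i))
  pointwise i with X i | Y i
  ... | false | _ = refl
  ... | true | true = refl
  ... | true | false = refl

∣∣-union : ∀ {n} (X Y Z : VSet n) → (∀ u → T (X u) → T (Y u) ⊎ T (Z u)) → ∣ X ∣ ≤ ∣ Y ∣ + ∣ Z ∣
∣∣-union {n} X Y Z h = ≤-trans (sumFin-mono n _ _ pointwise) (≤-reflexive (sumFin-+ n _ _))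
  where
  pointwise : ∀ i → indicator (X i) ≤ indicator (Y i) + indicator (Z i)
  pointwise i with X i | Y i | Z i | h i
  ... | false | _ | _ | _ = z≤n
  ... | true | true | _ | _ = s≤s z≤n
  ... | true | false | true | _ = s≤s z≤n
  ... | true | false | false | hi with hi tt
  ...   | inj₁ ()
  ...   | inj₂ ()

∣∣-∖ : ∀ {n} (S D : VSet n) → D ⊆ S → ∣ S ∣ ≡ ∣ S ∖ D ∣ + ∣ D ∣
∣∣-∖ S D D⊆S = trans (∣∣-split S D) (trans (cong (_+ ∣ S ∖ D ∣) (∣∣-cong S∩D≡D)) (+-comm ∣ D ∣ _))
  where
  S∩D≡D : ∀ u → (S u ∧ D u) ≡ D u
  S∩D≡D u = T-ext _ _ ∧-snd (λ du → ∧-intro (D⊆S u du) du)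

∣⁅⁆∣ : ∀ {n} (x : Fin n) → ∣ ⁅ x ⁆ ∣ ≡ 1
∣⁅⁆∣ {suc n} zero = cong suc (sumFin-zero n)
∣⁅⁆∣ {suc n} (suc x) = ∣⁅⁆∣ x

∣∣-remove : ∀ {n} (X : VSet n) {x} → T (X x) → ∣ X ∣ ≡ suc ∣ X ∖ ⁅ x ⁆ ∣
∣∣-remove X {x} xx = trans (∣∣-∖ X ⁅ x ⁆ (λ u e → subst (λ z → T (X z)) (sym (⁅⁆-elim e)) xx))
                           (trans (cong (∣ X ∖ ⁅ x ⁆ ∣ +_) (∣⁅⁆∣ x)) (+-comm _ 1))

∣∣-remove-≤ : ∀ {n} (X : VSet n) {x} c → T (X x) → ∣ X ∣ ≤ suc c → ∣ X ∖ ⁅ x ⁆ ∣ ≤ c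
∣∣-remove-≤ X c xx le = ≤-pred (≤-trans (≤-reflexive (sym (∣∣-remove X xx))) le)

∣∣-empty : ∀ {n} (X : VSet n) → ∣ X ∣ ≡ 0 → ∀ x → ¬ T (X x)
∣∣-empty {n} X e x xx = 1+n≰n (begin
  1                    ≡⟨ cong indicator (T⇒≡true xx) ⟨
  indicator (X x)      ≤⟨ term≤sumFin n _ x ⟩
  ∣ X ∣                ≡⟨ e ⟩
  0                    ∎)
  where open ≤-Reasoning

∣∣-nonempty : ∀ {n} (X : VSet n) → ¬ (∣ X ∣ ≡ 0) → Σ (Fin n) λ x → T (X x)
∣∣-nonempty {zero} X ne = ⊥-elim (ne refl)
∣∣-nonempty {suc n} X ne with X zero in eq
... | true = zero , ≡true⇒T eq
... | false with ∣∣-nonempty {n} (λ i → X (suc i)) ne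
...   | x , xx = suc x , xx

∣∣≡1 : ∀ {n} (X : VSet n) → ∣ X ∣ ≡ 1 → Σ (Fin n) λ a → T (X a) × (∀ w → T (X w) → w ≡ a)
∣∣≡1 X e with ∣∣-nonempty X (λ e₀ → 1+n≢0 (trans (sym e) e₀))
... | a , xa = a , xa , only-a
  where
  rest-empty : ∣ X ∖ ⁅ a ⁆ ∣ ≡ 0
  rest-empty = suc-injective (trans (sym (∣∣-remove X xa)) e)
  only-a : ∀ w → T (X w) → w ≡ a
  only-a w xw with fin-case w a
  ... | inj₁ w≡a = w≡a
  ... | inj₂ w≢a = ⊥-elim (∣∣-empty _ rest-empty w (∧-intro xw (not-intro (λ t → w≢a (⁅⁆-elim t)))))

∣∣≡2 : ∀ {n} (X : VSet n) → ∣ X ∣ ≡ 2 →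
  Σ (Fin n) λ a → Σ (Fin n) λ b → ¬ (a ≡ b) × T (X a) × T (X b) × (∀ w → T (X w) → (w ≡ a) ⊎ (w ≡ b))
∣∣≡2 X e with ∣∣-nonempty X (λ e₀ → 1+n≢0 (trans (sym e) e₀))
... | a , xa with ∣∣≡1 (X ∖ ⁅ a ⁆) (suc-injective (trans (sym (∣∣-remove X xa)) e))
...   | b , xb , only-b = a , b , a≢b , xa , ∧-fst xb , a-or-b
  where
  a≢b : ¬ (a ≡ b)
  a≢b refl = not-elim (∧-snd {X a} xb) (⁅⁆-self a)
  a-or-b : ∀ w → T (X w) → (w ≡ a) ⊎ (w ≡ b)
  a-or-b w xw with fin-case w a
  ... | inj₁ w≡a = inj₁ w≡a
  ... | inj₂ w≢a = inj₂ (only-b w (∧-intro xw (not-intro (λ t → w≢a (⁅⁆-elim t)))))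

double-counting : ∀ {n} (X Y : VSet n) (R : Fin n → VSet n) c →
  (∀ u → T (X u) → Σ (Fin n) λ d → T (Y d) × T (R d u)) →
  (∀ d → T (Y d) → ∣ R d ∣ ≤ c) → ∣ X ∣ ≤ c * ∣ Y ∣
double-counting {n} X Y R c covered small = begin
  ∣ X ∣                                                  ≤⟨ sumFin-mono n _ _ counted ⟩
  sumFin n (λ u → sumFin n (λ d → indicator (Y d ∧ R d u)))
                                                         ≡⟨ sumFin-swap n n (λ u d → indicator (Y d ∧ R d u)) ⟩
  sumFin n (λ d → sumFin n (λ u → indicator (Y d ∧ R d u)))
                                                         ≤⟨ sumFin-mono n _ _ fibre ⟩
  sumFin n (λ d → c * indicator (Y d))                   ≡⟨ sumFin-*ˡ n c _ ⟩
  c * ∣ Y ∣                                              ∎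
  where
  open ≤-Reasoning
  counted : ∀ u → indicator (X u) ≤ sumFin n (λ d → indicator (Y d ∧ R d u))
  counted u with T-case (X u)
  ... | inj₂ ¬xu = ≤-trans (≤-reflexive (cong indicator (¬T⇒≡false (not-elim ¬xu)))) z≤n
  ... | inj₁ xu with covered u xu
  ...   | d , yd , rdu = ≤-trans (indicator-mono _ _ (λ _ → ∧-intro yd rdu))
                                 (term≤sumFin n (λ d → indicator (Y d ∧ R d u)) d)
  fibre : ∀ d → sumFin n (λ u → indicator (Y d ∧ R d u)) ≤ c * indicator (Y d)
  fibre d with T-case (Y d)
  ... | inj₂ ¬yd rewrite ¬T⇒≡false (not-elim ¬yd) = ≤-reflexive (trans (sumFin-zero n) (sym (*-zeroʳ c)))
  ... | inj₁ yd rewrite T⇒≡true yd = ≤-trans (small d yd) (≤-reflexive (sym (*-identityʳ c)))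

record IsMIS {n} (G : Graph n) (S I : VSet n) : Set where
  field
    independent : ∀ u v → T (I u) → T (I v) → ¬ T (adj G u v)
    inside      : I ⊆ S
    dominating  : ∀ v → T (S v) → ¬ T (I v) → Σ (Fin n) λ u → T (I u) × T (adj G u v)
open IsMIS

IsMIS-fromᵇ : ∀ {n} (G : Graph n) (S I : VSet n) → T (maximalIndependentᵇ G S I) → IsMIS G S I
IsMIS-fromᵇ {n} G S I t = record { independent = indep ; inside = inside′ ; dominating = dom }
  where
  indep : ∀ u v → T (I u) → T (I v) → ¬ T (adj G u v)
  indep u v iu iv a =
    not-elim (all-elim _ (all-elim _ (∧-fst (∧-fst t)) u) v) (∧-intro iu (∧-intro iv a))
  inside′ : I ⊆ S
  inside′ u = ⇒-elim (all-elim _ (∧-snd (∧-fst {independentᵇ G S I} t)) u)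
  dom : ∀ v → T (S v) → ¬ T (I v) → Σ (Fin n) λ u → T (I u) × T (adj G u v)
  dom v sv ¬iv with ∨-elim (⇒-elim (all-elim _ (∧-snd {independentᵇ G S I} t) v) sv)
  ... | inj₁ iv = ⊥-elim (¬iv iv)
  ... | inj₂ some with any-elim _ some
  ...   | u , iu∧a = u , ∧-fst iu∧a , ∧-snd {I u} iu∧a

IsMIS-toᵇ : ∀ {n} (G : Graph n) (S I : VSet n) → IsMIS G S I → T (maximalIndependentᵇ G S I)
IsMIS-toᵇ {n} G S I m = ∧-intro (∧-intro indep inside′) dom
  where
  indep = all-intro _ λ u → all-intro _ λ v → not-intro λ t →
    independent m u v (∧-fst t) (∧-fst (∧-snd {I u} t)) (∧-snd {I v} (∧-snd {I u} t))
  inside′ = all-intro _ λ u → ⇒-intro (inside m u)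
  dominated : ∀ v → T (S v) → T (I v ∨ any (λ u → I u ∧ adj G u v) (allFin n))
  dominated v sv with T-case (I v)
  ... | inj₁ iv = ∨-inl iv
  ... | inj₂ ¬iv with dominating m v sv (not-elim ¬iv)
  ...   | u , iu , a = ∨-inr {I v} (any-intro _ u (∧-intro iu a))
  dom = all-intro _ λ v → ⇒-intro (dominated v)

misᵇ-cong : ∀ {n} (G : Graph n) {S S′ I J : VSet n} → (∀ v → S v ≡ S′ v) → (∀ v → I v ≡ J v) →
  maximalIndependentᵇ G S I ≡ maximalIndependentᵇ G S′ J
misᵇ-cong G {S} {S′} {I} {J} S≗S′ I≗J =
  T-ext _ _ (λ t → IsMIS-toᵇ G S′ J (transport (IsMIS-fromᵇ G S I t) S≗S′ I≗J))
            (λ t → IsMIS-toᵇ G S I (transport (IsMIS-fromᵇ G S′ J t) (λ v → sym (S≗S′ v)) (λ v → sym (I≗J v))))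
  where
  transport : ∀ {S S′ I J} → IsMIS G S I → (∀ v → S v ≡ S′ v) → (∀ v → I v ≡ J v) → IsMIS G S′ J
  transport m S≗ I≗ = record
    { independent = λ u v ju jv → independent m u v (subst T (sym (I≗ u)) ju) (subst T (sym (I≗ v)) jv)
    ; inside = λ u ju → subst T (S≗ u) (inside m u (subst T (sym (I≗ u)) ju))
    ; dominating = λ v sv ¬jv →
        let (u , iu , a) = dominating m v (subst T (sym (S≗ v)) sv) (λ iv → ¬jv (subst T (I≗ v) iv))
        in u , subst T (I≗ u) iu , a }

count-interleave : ∀ {A B : Set} (e₀ e₁ : A → B) (p : B → Bool) (xs : List A) →
  count p (foldr (λ x acc → e₀ x ∷ e₁ x ∷ acc) [] xs) ≡ count (λ x → p (e₀ x)) xs + count (λ x → p (e₁ x)) xs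
count-interleave e₀ e₁ p [] = refl
count-interleave e₀ e₁ p (x ∷ xs) = begin
  count p (e₀ x ∷ e₁ x ∷ rest)          ≡⟨ count-∷ p (e₀ x) _ ⟩
  i₀ + count p (e₁ x ∷ rest)            ≡⟨ cong (i₀ +_) (count-∷ p (e₁ x) _) ⟩
  i₀ + (i₁ + count p rest)              ≡⟨ cong (λ k → i₀ + (i₁ + k)) (count-interleave e₀ e₁ p xs) ⟩
  i₀ + (i₁ + (c₀ + c₁))                 ≡⟨ +-assoc i₀ i₁ _ ⟨
  (i₀ + i₁) + (c₀ + c₁)                 ≡⟨ +-interchange i₀ i₁ c₀ c₁ ⟩
  (i₀ + c₀) + (i₁ + c₁)                 ≡⟨ cong₂ _+_ (count-∷ (λ x → p (e₀ x)) x xs) (count-∷ (λ x → p (e₁ x)) x xs) ⟨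
  count (λ x → p (e₀ x)) (x ∷ xs) + count (λ x → p (e₁ x)) (x ∷ xs) ∎
  where
  open ≡-Reasoning
  rest = foldr (λ x acc → e₀ x ∷ e₁ x ∷ acc) [] xs
  i₀ = indicator (p (e₀ x))
  i₁ = indicator (p (e₁ x))
  c₀ = count (λ x → p (e₀ x)) xs
  c₁ = count (λ x → p (e₁ x)) xs

-- allSubsets (suc n) lists the two extensions (by vertex zero absent or present) of
-- every subset of Fin n, so a count over it splits into two counts over allSubsets n.
record Extensions (n : ℕ) : Set where
  field
    ext₀ ext₁ : VSet n → VSet (suc n)
    count-split : ∀ p → count p (allSubsets (suc n)) ≡
                        count (λ S → p (ext₀ S)) (allSubsets n) + count (λ S → p (ext₁ S)) (allSubsets n)

extensions : ∀ n → Extensions n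
extensions n = record { ext₀ = _ ; ext₁ = _ ; count-split = λ p → count-interleave _ _ p (allSubsets n) }

_∪_ : ∀ {n} → VSet n → VSet n → VSet n
(X ∪ Y) u = X u ∨ Y u

Extensional : ∀ {n} → (VSet n → Bool) → Set
Extensional {n} P = ∀ I J → (∀ v → I v ≡ J v) → P I ≡ P J

-- Inserting u is a bijection from the subsets avoiding u onto those containing u.
count-insert : ∀ n (u : Fin n) (P : VSet n → Bool) → Extensional P →
  count (λ I → I u ∧ P I) (allSubsets n) ≡ count (λ J → not (J u) ∧ P (J ∪ ⁅ u ⁆)) (allSubsets n)
count-insert (suc n) zero P P-ext = begin
  count (λ I → I zero ∧ P I) (allSubsets (suc n))                    ≡⟨ count-split _ ⟩
  count (λ _ → false) subs + count (λ S → P (ext₁ S)) subs            ≡⟨ cong (_+ count (λ S → P (ext₁ S)) subs) (count-none _ subs (λ _ → refl)) ⟩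
  count (λ S → P (ext₁ S)) subs                                       ≡⟨ count-cong _ _ subs (λ S → P-ext _ _ (inserted S)) ⟩
  count (λ S → P (ext₀ S ∪ ⁅ zero ⁆)) subs                             ≡⟨ +-identityʳ _ ⟨
  count (λ S → P (ext₀ S ∪ ⁅ zero ⁆)) subs + 0                         ≡⟨ cong (count (λ S → P (ext₀ S ∪ ⁅ zero ⁆)) subs +_) (count-none _ subs (λ _ → refl)) ⟨
  count (λ S → P (ext₀ S ∪ ⁅ zero ⁆)) subs + count (λ _ → false) subs  ≡⟨ count-split _ ⟨
  count (λ J → not (J zero) ∧ P (J ∪ ⁅ zero ⁆)) (allSubsets (suc n))   ∎
  where
  open ≡-Reasoning
  open Extensions (extensions n)
  subs = allSubsets n
  inserted : ∀ S v → ext₁ S v ≡ (ext₀ S ∪ ⁅ zero ⁆) v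
  inserted S zero = refl
  inserted S (suc i) = sym (∨-identityʳ (S i))
count-insert (suc n) (suc u) P P-ext = begin
  count (λ I → I (suc u) ∧ P I) (allSubsets (suc n))
    ≡⟨ count-split _ ⟩
  count (λ S → S u ∧ P (ext₀ S)) subs + count (λ S → S u ∧ P (ext₁ S)) subs
    ≡⟨ cong₂ _+_ (count-insert n u _ (restrict ext₀ ext₀-ok))
                 (count-insert n u _ (restrict ext₁ ext₁-ok)) ⟩
  count (λ S → not (S u) ∧ P (ext₀ (S ∪ ⁅ u ⁆))) subs + count (λ S → not (S u) ∧ P (ext₁ (S ∪ ⁅ u ⁆))) subs
    ≡⟨ cong₂ _+_ (count-cong _ _ subs (λ S → cong (not (S u) ∧_) (P-ext _ _ (commute ext₀ ext₀-ok S))))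
                 (count-cong _ _ subs (λ S → cong (not (S u) ∧_) (P-ext _ _ (commute ext₁ ext₁-ok S)))) ⟩
  count (λ S → not (S u) ∧ P (ext₀ S ∪ ⁅ suc u ⁆)) subs + count (λ S → not (S u) ∧ P (ext₁ S ∪ ⁅ suc u ⁆)) subs
    ≡⟨ count-split _ ⟨
  count (λ J → not (J (suc u)) ∧ P (J ∪ ⁅ suc u ⁆)) (allSubsets (suc n)) ∎
  where
  open ≡-Reasoning
  open Extensions (extensions n)
  subs = allSubsets n
  -- ext₀ and ext₁ only change vertex zero, so they commute with inserting u
  Extension : (VSet n → VSet (suc n)) → Set
  Extension e = (∀ I J → e I zero ≡ e J zero) × (∀ S i → e S (suc i) ≡ S i)
  restrict : ∀ e → Extension e → Extensional (λ S → P (e S))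
  restrict e (e-zero , e-suc) I J I≗J =
    P-ext _ _ λ { zero → e-zero I J ; (suc i) → trans (e-suc I i) (trans (I≗J i) (sym (e-suc J i))) }
  commute : ∀ e → Extension e → ∀ S v → e (S ∪ ⁅ u ⁆) v ≡ (e S ∪ ⁅ suc u ⁆) v
  commute e (e-zero , e-suc) S zero = trans (e-zero _ S) (sym (∨-identityʳ (e S zero)))
  commute e (e-zero , e-suc) S (suc i) = trans (e-suc _ i) (cong (_∨ _) (sym (e-suc S i)))
  ext₀-ok : Extension ext₀
  ext₀-ok = (λ _ _ → refl) , (λ _ _ → refl)
  ext₁-ok : Extension ext₁
  ext₁-ok = (λ _ _ → refl) , (λ _ _ → refl)

count-only-empty : ∀ n (P : VSet n → Bool) → (∀ I → T (P I) → ∀ v → I v ≡ false) →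
  count P (allSubsets n) ≤ 1
count-only-empty zero P h = ≤-trans (≤-reflexive (count-∷ P _ [])) (≤-trans (≤-reflexive (+-identityʳ _)) (indicator≤1 _))
  where
  indicator≤1 : ∀ b → indicator b ≤ 1
  indicator≤1 true = ≤-refl
  indicator≤1 false = z≤n
count-only-empty (suc n) P h = begin
  count P (allSubsets (suc n))                                         ≡⟨ count-split P ⟩
  count (λ S → P (ext₀ S)) (allSubsets n) + count (λ S → P (ext₁ S)) (allSubsets n)
                                                                       ≤⟨ +-mono-≤ without-zero (≤-reflexive with-zero) ⟩
  1 + 0                                                                ∎
  where
  open ≤-Reasoning
  open Extensions (extensions n)
  without-zero : count (λ S → P (ext₀ S)) (allSubsets n) ≤ 1
  without-zero = count-only-empty n (λ S → P (ext₀ S)) (λ S t v → h _ t (suc v))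
  with-zero : count (λ S → P (ext₁ S)) (allSubsets n) ≡ 0
  with-zero = count-none _ (allSubsets n) (λ S → ¬T⇒≡false (λ t → true≢false (h _ t zero)))
    where
    true≢false : ¬ (true ≡ false)
    true≢false ()

prodFin-compare : ∀ n (g h : Fin n → ℕ) (X : VSet n) a b →
  (∀ i → ¬ T (X i) → g i ≤ h i) → (∀ i → T (X i) → g i * a ≤ h i * b) →
  prodFin n g * a ^ ∣ X ∣ ≤ prodFin n h * b ^ ∣ X ∣
prodFin-compare zero g h X a b off on = ≤-refl
prodFin-compare (suc n) g h X a b off on with X zero in x₀
... | true = begin
  g zero * G′ * (a * a ^ ∣ X′ ∣)     ≡⟨ *-interchange (g zero) G′ a _ ⟩
  g zero * a * (G′ * a ^ ∣ X′ ∣)     ≤⟨ *-mono-≤ (on zero (≡true⇒T x₀)) rest ⟩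
  h zero * b * (H′ * b ^ ∣ X′ ∣)     ≡⟨ *-interchange (h zero) b H′ _ ⟩
  h zero * H′ * (b * b ^ ∣ X′ ∣)     ∎
  where
  open ≤-Reasoning
  X′ = λ i → X (suc i)
  G′ = prodFin n (λ i → g (suc i))
  H′ = prodFin n (λ i → h (suc i))
  rest = prodFin-compare n _ _ X′ a b (λ i → off (suc i)) (λ i → on (suc i))
... | false = begin
  g zero * G′ * a ^ ∣ X′ ∣     ≡⟨ *-assoc (g zero) G′ _ ⟩
  g zero * (G′ * a ^ ∣ X′ ∣)   ≤⟨ *-mono-≤ (off zero (λ t → subst T x₀ t)) rest ⟩
  h zero * (H′ * b ^ ∣ X′ ∣)   ≡⟨ *-assoc (h zero) H′ _ ⟨
  h zero * H′ * b ^ ∣ X′ ∣     ∎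
  where
  open ≤-Reasoning
  X′ = λ i → X (suc i)
  G′ = prodFin n (λ i → g (suc i))
  H′ = prodFin n (λ i → h (suc i))
  rest = prodFin-compare n _ _ X′ a b (λ i → off (suc i)) (λ i → on (suc i))

prodFin-lower : ∀ n (f : Fin n → ℕ) (X : VSet n) K → (∀ i → T (X i) → K ≤ f i) →
  K ^ ∣ X ∣ ≤ prodFin n (λ i → if X i then f i else 1)
prodFin-lower zero f X K h = ≤-refl
prodFin-lower (suc n) f X K h with X zero in x₀
... | true = *-mono-≤ (h zero (≡true⇒T x₀)) (prodFin-lower n _ (λ i → X (suc i)) K (λ i → h (suc i)))
... | false = ≤-trans (prodFin-lower n _ (λ i → X (suc i)) K (λ i → h (suc i))) (≤-reflexive (sym (+-identityʳ _)))

module Neighbourhoods {n : ℕ} (G : Graph n) where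

  adj-sym : ∀ u v → T (adj G u v) → T (adj G v u)
  adj-sym u v = subst T (Graph.sym G u v)

  no-loop : ∀ v → ¬ T (adj G v v)
  no-loop v = subst T (loopless G v)

  N : VSet n → Fin n → VSet n
  N S x y = S y ∧ adj G x y

  d : VSet n → Fin n → ℕ
  d S x = ∣ N S x ∣

  -- N[u] ∪ A inside S: the vertices deleted when u joins the independent set and A is excluded
  N[_]∪_within_ : Fin n → VSet n → VSet n → VSet n
  (N[ u ]∪ A within S) w = S w ∧ (⁅ u ⁆ w ∨ adj G u w ∨ A w)

  avoids : VSet n → VSet n → Bool
  avoids A I = all (λ x → not (A x ∧ I x)) (allFin n)

  avoids-elim : ∀ A I → T (avoids A I) → ∀ x → T (A x) → ¬ T (I x)
  avoids-elim A I t x ax ix = not-elim (all-elim _ t x) (∧-intro ax ix)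

  avoids-intro : ∀ A I → (∀ x → T (A x) → ¬ T (I x)) → T (avoids A I)
  avoids-intro A I h = all-intro _ (λ x → not-intro (λ t → h x (∧-fst t) (∧-snd {A x} t)))

  avoids-∅ : ∀ I → T (avoids ∅ I)
  avoids-∅ I = avoids-intro ∅ I (λ x ())

  avoids-ext : ∀ A → Extensional (avoids A)
  avoids-ext A I J I≗J = T-ext _ _ (move I≗J) (move (λ x → sym (I≗J x)))
    where
    move : ∀ {I J} → (∀ x → I x ≡ J x) → T (avoids A I) → T (avoids A J)
    move I≗J t = avoids-intro A _ (λ x ax jx → avoids-elim A _ t x ax (subst T (sym (I≗J x)) jx))

  MIS? : VSet n → VSet n → Bool
  MIS? = maximalIndependentᵇ G

  mis : VSet n → ℕ
  mis S = misInduced G S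

  in-or-neighbour : ∀ S I v → IsMIS G S I → T (S v) → T (I v) ⊎ Σ (Fin n) λ u → T (N S v u) × T (I u)
  in-or-neighbour S I v m sv with T-case (I v)
  ... | inj₁ iv = inj₁ iv
  ... | inj₂ ¬iv with dominating m v sv (not-elim ¬iv)
  ...   | u , iu , a = inj₂ (u , ∧-intro (inside m u iu) (adj-sym u v a) , iu)

  -- Branching: the maximal independent sets I of G[S] with u ∈ I and I ∩ A = ∅
  -- lose u to become maximal independent sets of G[S ∖ (N[u] ∪ A)], injectively.
  mis-branch : ∀ S u A → count (λ I → I u ∧ (avoids A I ∧ MIS? S I)) (allSubsets n)
                         ≤ mis (S ∖ (N[ u ]∪ A within S))
  mis-branch S u A = ≤-trans (≤-reflexive (count-insert n u _ P-ext)) (count-mono _ _ (allSubsets n) restricted)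
    where
    D = N[ u ]∪ A within S
    P-ext : Extensional (λ I → avoids A I ∧ MIS? S I)
    P-ext I J I≗J = cong₂ _∧_ (avoids-ext A I J I≗J) (misᵇ-cong G (λ _ → refl) I≗J)
    restricted : ∀ J → T (not (J u) ∧ (avoids A (J ∪ ⁅ u ⁆) ∧ MIS? S (J ∪ ⁅ u ⁆))) → T (MIS? (S ∖ D) J)
    restricted J t = IsMIS-toᵇ G _ J (record { independent = indep ; inside = inside′ ; dominating = dom })
      where
      ¬ju : ¬ T (J u)
      ¬ju = not-elim (∧-fst t)
      I = J ∪ ⁅ u ⁆
      I-avoids : T (avoids A I)
      I-avoids = ∧-fst (∧-snd {not (J u)} t)
      m : IsMIS G S I
      m = IsMIS-fromᵇ G S I (∧-snd {avoids A I} (∧-snd {not (J u)} t))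
      J⊆I : ∀ x → T (J x) → T (I x)
      J⊆I x = ∨-inl
      u∈I : T (I u)
      u∈I = ∨-inr {J u} (⁅⁆-self u)
      I≡J-off-u : ∀ x → ¬ (x ≡ u) → I x ≡ J x
      I≡J-off-u x x≢u = trans (cong (J x ∨_) (⁅⁆-other x≢u)) (∨-identityʳ (J x))
      indep : ∀ x y → T (J x) → T (J y) → ¬ T (adj G x y)
      indep x y jx jy = independent m x y (J⊆I x jx) (J⊆I y jy)
      inside′ : ∀ x → T (J x) → T ((S ∖ D) x)
      inside′ x jx = ∧-intro (inside m x (J⊆I x jx)) (not-intro λ dx → excluded (∨-elim (∧-snd {S x} dx)))
        where
        excluded : T (⁅ u ⁆ x) ⊎ T (adj G u x ∨ A x) → ⊥
        excluded (inj₁ x≡u) = ¬ju (subst (λ z → T (J z)) (⁅⁆-elim x≡u) jx)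
        excluded (inj₂ rest) with ∨-elim rest
        ... | inj₁ a = independent m u x u∈I (J⊆I x jx) a
        ... | inj₂ ax = avoids-elim A I I-avoids x ax (J⊆I x jx)
      dom : ∀ w → T ((S ∖ D) w) → ¬ T (J w) → Σ (Fin n) λ z → T (J z) × T (adj G z w)
      dom w sdw ¬jw with dominating m w sw ¬iw
        where
        sw = ∧-fst sdw
        ¬dw : ¬ T (D w)
        ¬dw = not-elim (∧-snd {S w} sdw)
        w≢u : ¬ (w ≡ u)
        w≢u refl = ¬dw (∧-intro sw (∨-inl (⁅⁆-self w)))
        ¬iw : ¬ T (I w)
        ¬iw t = ¬jw (subst T (I≡J-off-u w w≢u) t)
      ... | z , iz , a with fin-case z u
      ...   | inj₁ refl = ⊥-elim (not-elim (∧-snd {S w} sdw) (∧-intro (∧-fst sdw) (∨-inr {⁅ z ⁆ w} (∨-inl a))))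
      ...   | inj₂ z≢u = z , subst T (I≡J-off-u z z≢u) iz , a

num≤ : ∀ m n → {T (m ≤ᵇ n)} → m ≤ n
num≤ m n {t} = ≤ᵇ⇒≤ m n t

level : ℕ → ℕ → ℕ → ℕ → ℕ
level x₀ x₁ x₂ 0 = x₀
level x₀ x₁ x₂ 1 = x₁
level x₀ x₁ x₂ (suc (suc _)) = x₂

-- Vertex weights, scaled by 10⁴: 1 for degree 0, 1.4143 ≈ √2 for degree 1,
-- 1.406 for degree 2.
T0 F1 F2 : ℕ
T0 = 10000
F1 = 14143
F2 = 14060

weight : ℕ → ℕ
weight = level T0 F1 F2

T0≤weight : ∀ d → T0 ≤ weight d
T0≤weight 0 = ≤-refl
T0≤weight 1 = num≤ _ _
T0≤weight (suc (suc d)) = num≤ _ _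

F2≤weight : ∀ d → ¬ (d ≡ 0) → F2 ≤ weight d
F2≤weight 0 d≢0 = ⊥-elim (d≢0 refl)
F2≤weight 1 _ = num≤ _ _
F2≤weight (suc (suc d)) _ = ≤-refl

weight-drop : ∀ d′ d → d′ ≤ d → d ≤ 2 → weight d′ * F2 ≤ weight d * F1
weight-drop 0 0 _ _ = num≤ _ _
weight-drop 0 1 _ _ = num≤ _ _
weight-drop 0 2 _ _ = num≤ _ _
weight-drop 1 1 _ _ = num≤ _ _
weight-drop 1 2 _ _ = num≤ _ _
weight-drop 2 2 _ _ = num≤ _ _
weight-drop 1 0 () _
weight-drop 2 0 () _
weight-drop 2 1 (s≤s ()) _
weight-drop (suc (suc (suc _))) _ (s≤s (s≤s (s≤s _))) (s≤s (s≤s ()))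
weight-drop _ (suc (suc (suc _))) _ (s≤s (s≤s ()))

module Potential {n : ℕ} (G : Graph n) where
  open Neighbourhoods G

  MaxDeg2 : VSet n → Set
  MaxDeg2 S = ∀ u → T (S u) → d S u ≤ 2

  Pot : VSet n → ℕ
  Pot S = prodFin n (λ u → if S u then weight (d S u) else 1)

  Pot-part : VSet n → VSet n → ℕ
  Pot-part S D = prodFin n (λ u → if D u then weight (d S u) else 1)

  -- ∂ S D: the vertices of S ∖ D with a neighbour in D, whose degree drops when D is deleted
  ∂ : VSet n → VSet n → VSet n
  ∂ S D u = (S ∖ D) u ∧ any (λ x → D x ∧ adj G u x) (allFin n)

  potential-delete : ∀ S D → D ⊆ S → MaxDeg2 S →
    Pot (S ∖ D) * Pot-part S D * F2 ^ ∣ ∂ S D ∣ ≤ Pot S * F1 ^ ∣ ∂ S D ∣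
  potential-delete S D D⊆S md = begin
    Pot (S ∖ D) * Pot-part S D * F2 ^ k       ≡⟨ *-right-comm (Pot (S ∖ D)) _ _ ⟩
    Pot (S ∖ D) * F2 ^ k * Pot-part S D       ≤⟨ *-monoˡ-≤ (Pot-part S D) (prodFin-compare n new old (∂ S D) F2 F1 unaffected affected) ⟩
    prodFin n old * F1 ^ k * Pot-part S D     ≡⟨ *-right-comm (prodFin n old) _ _ ⟩
    prodFin n old * Pot-part S D * F1 ^ k     ≡⟨ cong (_* F1 ^ k) split ⟨
    Pot S * F1 ^ k                            ∎
    where
    open ≤-Reasoning
    k = ∣ ∂ S D ∣
    old new : Fin n → ℕ
    old u = if (S ∖ D) u then weight (d S u) else 1
    new u = if (S ∖ D) u then weight (d (S ∖ D) u) else 1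
    split : Pot S ≡ prodFin n old * Pot-part S D
    split = trans (prodFin-cong n _ _ pointwise) (prodFin-* n old _)
      where
      pointwise : ∀ u → (if S u then weight (d S u) else 1) ≡ old u * (if D u then weight (d S u) else 1)
      pointwise u with S u in su | D u in du
      ... | true | true = sym (*-identityˡ _)
      ... | true | false = sym (*-identityʳ _)
      ... | false | false = refl
      ... | false | true = ⊥-elim (subst T su (D⊆S u (≡true⇒T du)))
    unaffected : ∀ u → ¬ T (∂ S D u) → new u ≤ old u
    unaffected u u∉∂ with (S ∖ D) u in sdu
    ... | false = ≤-refl
    ... | true = ≤-reflexive (cong weight (∣∣-cong same-neighbours))
      where
      same-neighbours : ∀ w → ((S ∖ D) w ∧ adj G u w) ≡ (S w ∧ adj G u w)
      same-neighbours w with S w | D w in dw | adj G u w in uw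
      ... | false | _ | _ = refl
      ... | true | false | _ = refl
      ... | true | true | false = refl
      ... | true | true | true = ⊥-elim (u∉∂ (any-intro _ w (∧-intro (≡true⇒T dw) (≡true⇒T uw))))
    affected : ∀ u → T (∂ S D u) → new u * F2 ≤ old u * F1
    affected u u∈∂ with (S ∖ D) u in sdu
    ... | false = ⊥-elim u∈∂
    ... | true = weight-drop _ _ (∣∣-mono (λ w t → ∧-intro (∧-fst (∧-fst t)) (∧-snd {(S ∖ D) w} t)))
                                 (md u (∧-fst (≡true⇒T sdu)))

  ∂-elim : ∀ S D u → T (∂ S D u) → T (S u) × ¬ T (D u) × Σ (Fin n) λ x → T (D x) × T (adj G x u)
  ∂-elim S D u t with any-elim _ (∧-snd {(S ∖ D) u} t)
  ... | x , dx∧a = ∧-fst (∧-fst t) , not-elim (∧-snd {S u} (∧-fst t)) , x , ∧-fst dx∧a , adj-sym u x (∧-snd {D x} dx∧a)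

  N[]-⊆ : ∀ w A S → (N[ w ]∪ A within S) ⊆ S
  N[]-⊆ w A S x = ∧-fst

  N[]-self : ∀ w A S → T (S w) → T ((N[ w ]∪ A within S) w)
  N[]-self w A S sw = ∧-intro sw (∨-inl (⁅⁆-self w))

  N[]-neighbour : ∀ w A S x → T (N S w x) → T ((N[ w ]∪ A within S) x)
  N[]-neighbour w A S x nx = ∧-intro (∧-fst nx) (∨-inr {⁅ w ⁆ x} (∨-inl (∧-snd {S x} nx)))

  N[]-extra : ∀ w A S x → T (S x) → T (A x) → T ((N[ w ]∪ A within S) x)
  N[]-extra w A S x sx ax = ∧-intro sx (∨-inr {⁅ w ⁆ x} (∨-inr {adj G w x} ax))

  N[]-cases : ∀ w A S x → T ((N[ w ]∪ A within S) x) → (x ≡ w) ⊎ T (N S w x) ⊎ T (A x)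
  N[]-cases w A S x t with ∨-elim {⁅ w ⁆ x} (∧-snd {S x} t)
  ... | inj₁ e = inj₁ (⁅⁆-elim e)
  ... | inj₂ rest with ∨-elim {adj G w x} rest
  ...   | inj₁ a = inj₂ (inj₁ (∧-intro (∧-fst t) a))
  ...   | inj₂ ax = inj₂ (inj₂ ax)

  ∣N[]∣ : ∀ S w → T (S w) → ∣ N[ w ]∪ ∅ within S ∣ ≡ suc (d S w)
  ∣N[]∣ S w sw = trans (∣∣-remove (N[ w ]∪ ∅ within S) (N[]-self w ∅ S sw)) (cong suc (∣∣-cong same))
    where
    same : ∀ x → ((N[ w ]∪ ∅ within S) ∖ ⁅ w ⁆) x ≡ N S w x
    same x = T-ext _ _ to from
      where
      to : T (((N[ w ]∪ ∅ within S) ∖ ⁅ w ⁆) x) → T (N S w x)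
      to t with N[]-cases w ∅ S x (∧-fst t)
      ... | inj₁ refl = ⊥-elim (not-elim (∧-snd {(N[ w ]∪ ∅ within S) x} t) (⁅⁆-self x))
      ... | inj₂ (inj₁ nx) = nx
      from : T (N S w x) → T (((N[ w ]∪ ∅ within S) ∖ ⁅ w ⁆) x)
      from nx = ∧-intro (N[]-neighbour w ∅ S x nx) (not-intro λ e → no-loop w (subst (λ z → T (adj G w z)) (⁅⁆-elim e) (∧-snd {S x} nx)))

  ∣N[]∪⁅⁆∣ : ∀ S b a → T (S b) → T (S a) → ¬ (a ≡ b) → ¬ T (adj G b a) →
    ∣ N[ b ]∪ ⁅ a ⁆ within S ∣ ≡ suc (suc (d S b))
  ∣N[]∪⁅⁆∣ S b a sb sa a≢b ¬ba = trans (∣∣-remove (N[ b ]∪ ⁅ a ⁆ within S) (N[]-extra b ⁅ a ⁆ S a sa (⁅⁆-self a))) (cong suc (trans (∣∣-cong same) (∣N[]∣ S b sb)))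
    where
    same : ∀ x → ((N[ b ]∪ ⁅ a ⁆ within S) ∖ ⁅ a ⁆) x ≡ (N[ b ]∪ ∅ within S) x
    same x = T-ext _ _ to from
      where
      to : T (((N[ b ]∪ ⁅ a ⁆ within S) ∖ ⁅ a ⁆) x) → T ((N[ b ]∪ ∅ within S) x)
      to t with N[]-cases b ⁅ a ⁆ S x (∧-fst t)
      ... | inj₁ refl = N[]-self x ∅ S (∧-fst (∧-fst t))
      ... | inj₂ (inj₁ nx) = N[]-neighbour b ∅ S x nx
      ... | inj₂ (inj₂ x≡a) = ⊥-elim (not-elim (∧-snd {(N[ b ]∪ ⁅ a ⁆ within S) x} t) x≡a)
      from : T ((N[ b ]∪ ∅ within S) x) → T (((N[ b ]∪ ⁅ a ⁆ within S) ∖ ⁅ a ⁆) x)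
      from t with N[]-cases b ∅ S x t
      ... | inj₁ refl = ∧-intro (N[]-self x ⁅ a ⁆ S sb) (not-intro λ e → a≢b (sym (⁅⁆-elim e)))
      ... | inj₂ (inj₁ nx) = ∧-intro (N[]-neighbour b ⁅ a ⁆ S x nx) (not-intro λ e → ¬ba (subst (λ z → T (adj G b z)) (⁅⁆-elim e) (∧-snd {S x} nx)))

  -- Every boundary vertex of N[w] is a neighbour, other than w, of a neighbour of w.
  ∣∂N[]∣ : ∀ S w c → T (S w) → (∀ x → T (N S w x) → d S x ≤ suc c) → ∣ ∂ S (N[ w ]∪ ∅ within S) ∣ ≤ c * d S w
  ∣∂N[]∣ S w c sw small = double-counting _ (N S w) (λ x → N S x ∖ ⁅ w ⁆) c witness fibre
    where
    witness : ∀ u → T (∂ S (N[ w ]∪ ∅ within S) u) → Σ (Fin n) λ x → T (N S w x) × T ((N S x ∖ ⁅ w ⁆) u)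
    witness u t with ∂-elim S _ u t
    ... | su , u∉D , x , x∈D , xu with N[]-cases w ∅ S x x∈D
    ...   | inj₁ refl = ⊥-elim (u∉D (N[]-neighbour x ∅ S u (∧-intro su xu)))
    ...   | inj₂ (inj₁ nx) = x , nx , ∧-intro (∧-intro su xu) (not-intro λ e → u∉D (subst (λ z → T ((N[ w ]∪ ∅ within S) z)) (sym (⁅⁆-elim e)) (N[]-self w ∅ S sw)))
    fibre : ∀ x → T (N S w x) → ∣ N S x ∖ ⁅ w ⁆ ∣ ≤ c
    fibre x nx = ∣∣-remove-≤ (N S x) c (∧-intro sw (adj-sym w x (∧-snd {S x} nx))) (small x nx)

  -- At a vertex v with N(v) = {a, b}, deleting N[b] ∪ {a} leaves at most two boundary
  -- vertices: the neighbour of a other than v, and a neighbour of b's other neighbour.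
  ∣∂N[]∪⁅⁆∣ : ∀ S v a b → MaxDeg2 S → T (S v) → T (N S v a) → T (N S v b) →
    (∀ z → T (N S v z) → (z ≡ a) ⊎ (z ≡ b)) → ∣ ∂ S (N[ b ]∪ ⁅ a ⁆ within S) ∣ ≤ 2
  ∣∂N[]∪⁅⁆∣ S v a b md sv va vb N[v]≡ab = begin
    ∣ ∂ S D ∣               ≤⟨ ∣∣-union _ A₁ rest (λ u t → split u t) ⟩
    ∣ A₁ ∣ + ∣ rest ∣       ≤⟨ +-mono-≤ (∣∣-remove-≤ (N S a) 1 (∧-intro sv (adj-sym v a (∧-snd {S a} va))) (md a sa))
                                         (≤-trans (double-counting rest Y R 1 witness fibre) (*-monoʳ-≤ 1 Y≤1)) ⟩
    1 + 1                   ∎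
    where
    open ≤-Reasoning
    D = N[ b ]∪ ⁅ a ⁆ within S
    sa = ∧-fst va
    sb = ∧-fst vb
    A₁ rest Y : VSet n
    A₁ = N S a ∖ ⁅ v ⁆
    rest = ∂ S D ∖ A₁
    Y = N S b ∖ ⁅ v ⁆
    R : Fin n → VSet n
    R x = N S x ∖ ⁅ b ⁆
    split : ∀ u → T (∂ S D u) → T (A₁ u) ⊎ T (rest u)
    split u t with T-case (A₁ u)
    ... | inj₁ a₁ = inj₁ a₁
    ... | inj₂ ¬a₁ = inj₂ (∧-intro t ¬a₁)
    Y≤1 : ∣ Y ∣ ≤ 1
    Y≤1 = ∣∣-remove-≤ (N S b) 1 (∧-intro sv (adj-sym v b (∧-snd {S b} vb))) (md b sb)
    fibre : ∀ x → T (Y x) → ∣ R x ∣ ≤ 1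
    fibre x yx = ∣∣-remove-≤ (N S x) 1 (∧-intro sb (adj-sym b x (∧-snd {S x} (∧-fst yx)))) (md x (∧-fst (∧-fst yx)))
    v∈D : T (D v)
    v∈D = N[]-neighbour b ⁅ a ⁆ S v (∧-intro sv (adj-sym v b (∧-snd {S b} vb)))
    witness : ∀ u → T (rest u) → Σ (Fin n) λ x → T (Y x) × T (R x u)
    witness u t with ∂-elim S D u (∧-fst t)
    ... | su , u∉D , x , x∈D , xu with N[]-cases b ⁅ a ⁆ S x x∈D
    ...   | inj₁ refl = ⊥-elim (u∉D (N[]-neighbour x ⁅ a ⁆ S u (∧-intro su xu)))
    ...   | inj₂ (inj₂ x≡a) with refl ← ⁅⁆-elim {x = a} {x} x≡a =
              ⊥-elim (not-elim (∧-snd {∂ S D u} t) (∧-intro (∧-intro su xu)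
                        (not-intro λ e → u∉D (subst (λ z → T (D z)) (sym (⁅⁆-elim e)) v∈D))))
    ...   | inj₂ (inj₁ bx) with fin-case x v
    ...     | inj₁ refl = ⊥-elim (u∉D (u∈D (N[v]≡ab u (∧-intro su xu))))
      where
      u∈D : (u ≡ a) ⊎ (u ≡ b) → T (D u)
      u∈D (inj₁ refl) = N[]-extra b ⁅ u ⁆ S u su (⁅⁆-self u)
      u∈D (inj₂ refl) = N[]-self u ⁅ a ⁆ S su
    ...     | inj₂ x≢v = x , ∧-intro bx (not-intro (λ e → x≢v (⁅⁆-elim e))) ,
                         ∧-intro (∧-intro su xu) (not-intro λ e → u∉D (subst (λ z → T (D z)) (sym (⁅⁆-elim e)) (N[]-self b ⁅ a ⁆ S sb)))

  MaxDeg2-∖ : ∀ S D → MaxDeg2 S → MaxDeg2 (S ∖ D)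
  MaxDeg2-∖ S D md u sdu = ≤-trans (∣∣-mono (λ w t → ∧-intro (∧-fst (∧-fst t)) (∧-snd {(S ∖ D) w} t))) (md u (∧-fst sdu))

cancelʳ : ∀ M P C → 0 < C → M * C ≤ P * C → M ≤ P
cancelʳ M P (suc C) _ le = *-cancelʳ-≤ M P (suc C) le

-- y ≤[ E / C ] P : y is at most the fraction E / C of P, cleared of denominators.
-- (A record, so that E, C and P can be read off its type.)
infix 4 _≤[_/_]_
record _≤[_/_]_ (y E C P : ℕ) : Set where
  constructor cleared
  field uncleared : y * C ≤ P * E
open _≤[_/_]_

≤[]-+ : ∀ {y₁ y₂ E₁ E₂ C₁ C₂ P} → y₁ ≤[ E₁ / C₁ ] P → y₂ ≤[ E₂ / C₂ ] P →
  (y₁ + y₂) ≤[ E₁ * C₂ + E₂ * C₁ / C₁ * C₂ ] P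
≤[]-+ {y₁} {y₂} {E₁} {E₂} {C₁} {C₂} {P} (cleared h₁) (cleared h₂) = cleared (begin
  (y₁ + y₂) * (C₁ * C₂)                  ≡⟨ expand y₁ y₂ C₁ C₂ ⟩
  y₁ * C₁ * C₂ + y₂ * C₂ * C₁            ≤⟨ +-mono-≤ (*-monoˡ-≤ C₂ h₁) (*-monoˡ-≤ C₁ h₂) ⟩
  P * E₁ * C₂ + P * E₂ * C₁              ≡⟨ collect P E₁ E₂ C₁ C₂ ⟩
  P * (E₁ * C₂ + E₂ * C₁)                ∎)
  where
  open ≤-Reasoning
  expand : ∀ y₁ y₂ c₁ c₂ → (y₁ + y₂) * (c₁ * c₂) ≡ y₁ * c₁ * c₂ + y₂ * c₂ * c₁
  expand = solve-∀
  collect : ∀ p e₁ e₂ c₁ c₂ → p * e₁ * c₂ + p * e₂ * c₁ ≡ p * (e₁ * c₂ + e₂ * c₁)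
  collect = solve-∀

≤[]-conclude : ∀ {M y E C P} → M ≤ y → y ≤[ E / C ] P → E ≤ C → 0 < C → M ≤ P
≤[]-conclude {M} {y} {E} {C} {P} M≤y (cleared h) E≤C C>0 =
  cancelʳ M P C C>0 (≤-trans (*-monoˡ-≤ C M≤y) (≤-trans h (*-monoʳ-≤ P E≤C)))

branch-arith : ∀ t f₁ f₂ x s s′ d p′ pd a m K P → f₂ ≤ f₁ →
  x * t ^ s′ ≤ p′ → p′ * pd * f₂ ^ a ≤ P * f₁ ^ a → K ^ d ≤ pd → a ≤ m → s ≡ s′ + d →
  x * t ^ s ≤[ f₁ ^ m * t ^ d / K ^ d * f₂ ^ m ] P
branch-arith t f₁ f₂ x s s′ d p′ pd a m K P f₂≤f₁ bound delete lower a≤m s≡ = cleared (begin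
  x * t ^ s * (K ^ d * f₂ ^ m)
    ≡⟨ cong₂ (λ u w → x * u * (K ^ d * w)) (trans (cong (t ^_) s≡) (^-distribˡ-+-* t s′ d))
                                           (trans (cong (f₂ ^_) (sym m≡)) (^-distribˡ-+-* f₂ a e)) ⟩
  x * (t ^ s′ * t ^ d) * (K ^ d * (f₂ ^ a * f₂ ^ e))
    ≡⟨ regroup x (t ^ s′) (t ^ d) (K ^ d) (f₂ ^ a) (f₂ ^ e) ⟩
  x * t ^ s′ * K ^ d * f₂ ^ a * (t ^ d * f₂ ^ e)
    ≤⟨ *-monoˡ-≤ (t ^ d * f₂ ^ e) (*-monoˡ-≤ (f₂ ^ a) (*-mono-≤ bound lower)) ⟩
  p′ * pd * f₂ ^ a * (t ^ d * f₂ ^ e)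
    ≤⟨ *-mono-≤ delete (*-monoʳ-≤ (t ^ d) (^-monoˡ-≤ e f₂≤f₁)) ⟩
  P * f₁ ^ a * (t ^ d * f₁ ^ e)
    ≡⟨ regroup′ P (f₁ ^ a) (t ^ d) (f₁ ^ e) ⟩
  P * (f₁ ^ a * f₁ ^ e * t ^ d)
    ≡⟨ cong (λ u → P * (u * t ^ d)) (trans (sym (^-distribˡ-+-* f₁ a e)) (cong (f₁ ^_) m≡)) ⟩
  P * (f₁ ^ m * t ^ d) ∎)
  where
  open ≤-Reasoning
  e = m ∸ a
  m≡ : a + e ≡ m
  m≡ = m+[n∸m]≡n a≤m
  regroup : ∀ x t₁ t₂ k g₁ g₂ → x * (t₁ * t₂) * (k * (g₁ * g₂)) ≡ x * t₁ * k * g₁ * (t₂ * g₂)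
  regroup = solve-∀
  regroup′ : ∀ p f u g → p * f * (u * g) ≡ p * (f * g * u)
  regroup′ = solve-∀

-- Recurrences for mis: every maximal independent set meets N[v].
module Branching {n : ℕ} (G : Graph n) where
  open Neighbourhoods G

  through : VSet n → Fin n → VSet n → VSet n → Bool
  through S u A I = I u ∧ (avoids A I ∧ MIS? S I)

  mis-isolated : ∀ S v → T (S v) → d S v ≡ 0 → mis S ≤ mis (S ∖ (N[ v ]∪ ∅ within S))
  mis-isolated S v sv d≡0 = ≤-trans (count-mono (MIS? S) _ (allSubsets n) contains-v) (mis-branch S v ∅)
    where
    contains-v : ∀ I → T (MIS? S I) → T (through S v ∅ I)
    contains-v I t with in-or-neighbour S I v (IsMIS-fromᵇ G S I t) sv
    ... | inj₁ iv = ∧-intro iv (∧-intro (avoids-∅ I) t)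
    ... | inj₂ (u , vu , _) = ⊥-elim (∣∣-empty (N S v) d≡0 u vu)

  mis-leaf : ∀ S v a → T (S v) → (∀ z → T (N S v z) → z ≡ a) →
    mis S ≤ mis (S ∖ (N[ v ]∪ ∅ within S)) + mis (S ∖ (N[ a ]∪ ∅ within S))
  mis-leaf S v a sv N[v]≡a =
    ≤-trans (count-union (MIS? S) _ _ (allSubsets n) v-or-a) (+-mono-≤ (mis-branch S v ∅) (mis-branch S a ∅))
    where
    v-or-a : ∀ I → T (MIS? S I) → T (through S v ∅ I) ⊎ T (through S a ∅ I)
    v-or-a I t with in-or-neighbour S I v (IsMIS-fromᵇ G S I t) sv
    ... | inj₁ iv = inj₁ (∧-intro iv (∧-intro (avoids-∅ I) t))
    ... | inj₂ (u , vu , iu) = inj₂ (∧-intro (subst (λ z → T (I z)) (N[v]≡a u vu) iu) (∧-intro (avoids-∅ I) t))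

  -- With N(v) ⊆ {a, b}: I contains v, or a, or b but not a.
  mis-pair : ∀ S v a b → T (S v) → (∀ z → T (N S v z) → (z ≡ a) ⊎ (z ≡ b)) →
    mis S ≤ mis (S ∖ (N[ v ]∪ ∅ within S)) + (mis (S ∖ (N[ a ]∪ ∅ within S)) + mis (S ∖ (N[ b ]∪ ⁅ a ⁆ within S)))
  mis-pair S v a b sv N[v]≡ab =
    ≤-trans (count-union (MIS? S) _ (λ I → through S a ∅ I ∨ through S b ⁅ a ⁆ I) (allSubsets n) cases)
    (+-mono-≤ (mis-branch S v ∅)
              (≤-trans (count-union _ _ _ (allSubsets n) (λ I t → ∨-elim {through S a ∅ I} t))
                       (+-mono-≤ (mis-branch S a ∅) (mis-branch S b ⁅ a ⁆))))
    where
    cases : ∀ I → T (MIS? S I) → T (through S v ∅ I) ⊎ T (through S a ∅ I ∨ through S b ⁅ a ⁆ I)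
    cases I t with in-or-neighbour S I v (IsMIS-fromᵇ G S I t) sv
    ... | inj₁ iv = inj₁ (∧-intro iv (∧-intro (avoids-∅ I) t))
    ... | inj₂ (u , vu , iu) with N[v]≡ab u vu
    ...   | inj₁ refl = inj₂ (∨-inl (∧-intro iu (∧-intro (avoids-∅ I) t)))
    ...   | inj₂ refl with T-case (I a)
    ...     | inj₁ ia = inj₂ (∨-inl (∧-intro ia (∧-intro (avoids-∅ I) t)))
    ...     | inj₂ ¬ia = inj₂ (∨-inr {through S a ∅ I} (∧-intro iu (∧-intro a-avoided t)))
      where
      a-avoided : T (avoids ⁅ a ⁆ I)
      a-avoided = avoids-intro ⁅ a ⁆ I (λ x x≡a ix → not-elim ¬ia (subst (λ z → T (I z)) (⁅⁆-elim x≡a) ix))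

module MeasureBound {n : ℕ} (G : Graph n) (triangle-free : TriangleFree G) where
  open Neighbourhoods G
  open Potential G
  open Branching G

  Bound : ℕ → Set
  Bound k = ∀ S → ∣ S ∣ ≤ k → MaxDeg2 S → mis S * T0 ^ ∣ S ∣ ≤ Pot S

  bound-empty : ∀ S → ∣ S ∣ ≡ 0 → mis S * T0 ^ ∣ S ∣ ≤ Pot S
  bound-empty S ∣S∣≡0 = begin
    mis S * T0 ^ ∣ S ∣   ≡⟨ cong (λ z → mis S * T0 ^ z) ∣S∣≡0 ⟩
    mis S * 1            ≡⟨ *-identityʳ _ ⟩
    mis S                ≤⟨ count-only-empty n (MIS? S) only-empty ⟩
    1                    ≤⟨ prodFin-positive n _ (λ u → positive (S u) (d S u)) ⟩
    Pot S                ∎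
    where
    open ≤-Reasoning
    only-empty : ∀ I → T (MIS? S I) → ∀ v → I v ≡ false
    only-empty I t v = ¬T⇒≡false (λ iv → ∣∣-empty S ∣S∣≡0 v (inside (IsMIS-fromᵇ G S I t) v iv))
    positive : ∀ b d → 1 ≤ (if b then weight d else 1)
    positive true d = ≤-trans (num≤ 1 T0) (T0≤weight d)
    positive false d = ≤-refl

  has-degree : VSet n → ℕ → Fin n → Bool
  has-degree S j v = S v ∧ (d S v ≡ᵇ j)

  none-of-degree : ∀ S j → T (not (any (has-degree S j) (allFin n))) → ∀ u → T (S u) → ¬ (d S u ≡ j)
  none-of-degree S j t u su e = not-elim t (any-intro _ u (∧-intro su (≡⇒≡ᵇ _ _ e)))

  degree-1-or-2 : ∀ e → e ≤ 2 → ¬ (e ≡ 0) → (e ≡ 1) ⊎ (e ≡ 2)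
  degree-1-or-2 0 _ e≢0 = ⊥-elim (e≢0 refl)
  degree-1-or-2 1 _ _ = inj₁ refl
  degree-1-or-2 2 _ _ = inj₂ refl
  degree-1-or-2 (suc (suc (suc _))) (s≤s (s≤s ())) _

  data Shape (S : VSet n) : Set where
    empty    : ∣ S ∣ ≡ 0 → Shape S
    isolated : ∀ v → T (S v) → d S v ≡ 0 → Shape S
    leaf     : ∀ v → T (S v) → d S v ≡ 1 → (∀ u → T (S u) → ¬ (d S u ≡ 0)) → Shape S
    regular  : ∀ v → T (S v) → (∀ u → T (S u) → d S u ≡ 2) → Shape S

  shape : ∀ S → MaxDeg2 S → Shape S
  shape S md with T-case (any (has-degree S 0) (allFin n))
  ... | inj₁ t with any-elim _ t
  ...   | v , tv = isolated v (∧-fst tv) (≡ᵇ⇒≡ _ _ (∧-snd {S v} tv))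
  shape S md | inj₂ no-isolated with T-case (any (has-degree S 1) (allFin n))
  ... | inj₁ t with any-elim _ t
  ...   | v , tv = leaf v (∧-fst tv) (≡ᵇ⇒≡ _ _ (∧-snd {S v} tv)) (none-of-degree S 0 no-isolated)
  shape S md | inj₂ no-isolated | inj₂ no-leaf with ∣ S ∣ in size
  ... | zero = empty size
  ... | suc _ with ∣∣-nonempty S (λ e → 1+n≢0 (trans (sym size) e))
  ...   | v , sv = regular v sv degree-2
    where
    degree-2 : ∀ u → T (S u) → d S u ≡ 2
    degree-2 u su with degree-1-or-2 (d S u) (md u su) (none-of-degree S 0 no-isolated u su)
    ... | inj₁ d≡1 = ⊥-elim (none-of-degree S 1 no-leaf u su d≡1)
    ... | inj₂ d≡2 = d≡2

  module Step (k : ℕ) (IH : Bound k) (S : VSet n) (S≤ : ∣ S ∣ ≤ suc k) (md : MaxDeg2 S) where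

    branch : ∀ D δ K m → D ⊆ S → ∣ D ∣ ≡ suc δ → (∀ u → T (D u) → K ≤ weight (d S u)) → ∣ ∂ S D ∣ ≤ m →
      mis (S ∖ D) * T0 ^ ∣ S ∣ ≤[ F1 ^ m * T0 ^ suc δ / K ^ suc δ * F2 ^ m ] Pot S
    branch D δ K m D⊆S ∣D∣ heavy ∂≤m =
      branch-arith T0 F1 F2 (mis (S ∖ D)) (∣ S ∣) (∣ S ∖ D ∣) (suc δ) (Pot (S ∖ D)) (Pot-part S D) (∣ ∂ S D ∣) m K (Pot S)
        (num≤ F2 F1) (IH (S ∖ D) smaller (MaxDeg2-∖ S D md)) (potential-delete S D D⊆S md)
        (subst (λ z → K ^ z ≤ Pot-part S D) ∣D∣ (prodFin-lower n _ D K heavy)) ∂≤m size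
      where
      size : ∣ S ∣ ≡ ∣ S ∖ D ∣ + suc δ
      size = trans (∣∣-∖ S D D⊆S) (cong (∣ S ∖ D ∣ +_) ∣D∣)
      smaller : ∣ S ∖ D ∣ ≤ k
      smaller = ≤-pred (≤-trans (m<m+n (∣ S ∖ D ∣) (s≤s z≤n)) (≤-trans (≤-reflexive (sym size)) S≤))

    heavy-F2 : ∀ D → D ⊆ S → (∀ u → T (S u) → ¬ (d S u ≡ 0)) → ∀ u → T (D u) → F2 ≤ weight (d S u)
    heavy-F2 D D⊆S no-isolated u du = F2≤weight (d S u) (no-isolated u (D⊆S u du))

    N[_] : Fin n → VSet n
    N[ w ] = N[ w ]∪ ∅ within S

    scale₂ : ∀ x y → mis S ≤ x + y → mis S * T0 ^ ∣ S ∣ ≤ x * T0 ^ ∣ S ∣ + y * T0 ^ ∣ S ∣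
    scale₂ x y h = ≤-trans (*-monoˡ-≤ (T0 ^ ∣ S ∣) h) (≤-reflexive (*-distribʳ-+ (T0 ^ ∣ S ∣) x y))

    scale₃ : ∀ x y z → mis S ≤ x + (y + z) →
      mis S * T0 ^ ∣ S ∣ ≤ x * T0 ^ ∣ S ∣ + (y * T0 ^ ∣ S ∣ + z * T0 ^ ∣ S ∣)
    scale₃ x y z h = ≤-trans (scale₂ x (y + z) h) (≤-reflexive (cong (x * T0 ^ ∣ S ∣ +_) (*-distribʳ-+ (T0 ^ ∣ S ∣) y z)))

    -- An isolated vertex v lies in every maximal independent set; deleting it costs nothing.
    bound-isolated : ∀ v → T (S v) → d S v ≡ 0 → mis S * T0 ^ ∣ S ∣ ≤ Pot S
    bound-isolated v sv d≡0 =
      ≤[]-conclude (*-monoˡ-≤ (T0 ^ ∣ S ∣) (mis-isolated S v sv d≡0))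
        (branch N[ v ] 0 T0 0 (N[]-⊆ v ∅ S) (trans (∣N[]∣ S v sv) (cong suc d≡0))
                (λ u _ → T0≤weight _)
                (∣∂N[]∣ S v 0 sv (λ x vx → ⊥-elim (∣∣-empty (N S v) d≡0 x vx))))
        (num≤ _ _) (num≤ 1 _)

    -- v and its unique neighbour a both have degree 1 (an isolated edge): two branches
    -- deleting two vertices of weight 1.4143 each, and 2 / 1.4143² ≤ 1.
    bound-edge : ∀ v a → T (S v) → d S v ≡ 1 → T (N S v a) → (∀ z → T (N S v z) → z ≡ a) → d S a ≡ 1 →
      mis S * T0 ^ ∣ S ∣ ≤ Pot S
    bound-edge v a sv dv va N[v]≡a da =
      ≤[]-conclude (scale₂ (mis (S ∖ N[ v ])) (mis (S ∖ N[ a ])) (mis-leaf S v a sv N[v]≡a))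
        (≤[]-+ (branch N[ v ] 1 F1 0 (N[]-⊆ v ∅ S) (trans (∣N[]∣ S v sv) (cong suc dv))
                       (degree-1 v a dv da N[v]≡a) (∣∂N[]∣ S v 0 sv λ x vx → ≤-reflexive (trans (cong (d S) (N[v]≡a x vx)) da)))
               (branch N[ a ] 1 F1 0 (N[]-⊆ a ∅ S) (trans (∣N[]∣ S a sa) (cong suc da))
                       (degree-1 a v da dv N[a]≡v) (∣∂N[]∣ S a 0 sa λ x ax → ≤-reflexive (trans (cong (d S) (N[a]≡v x ax)) dv))))
        (num≤ _ _) (num≤ 1 _)
      where
      sa = ∧-fst va
      av : T (N S a v)
      av = ∧-intro sv (adj-sym v a (∧-snd {S a} va))
      N[a]≡v : ∀ z → T (N S a z) → z ≡ v
      N[a]≡v z az with ∣∣≡1 (N S a) da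
      ... | _ , _ , only = trans (only z az) (sym (only v av))
      degree-1 : ∀ x y → d S x ≡ 1 → d S y ≡ 1 → (∀ z → T (N S x z) → z ≡ y) →
                 ∀ u → T (N[ x ] u) → F1 ≤ weight (d S u)
      degree-1 x y dx dy N[x]≡y u t with N[]-cases x ∅ S u t
      ... | inj₁ refl = ≤-reflexive (cong weight (sym dx))
      ... | inj₂ (inj₁ xu) = ≤-reflexive (cong weight (sym (trans (cong (d S) (N[x]≡y u xu)) dy)))

    -- v has degree 1 and its unique neighbour a has degree 2: branching on v or a costs
    -- 1.4143 / 1.406³ + 1.4143² / 1.406⁵ ≤ 1.
    bound-leaf : ∀ v a → T (S v) → d S v ≡ 1 → T (N S v a) → (∀ z → T (N S v z) → z ≡ a) → d S a ≡ 2 →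
      (∀ u → T (S u) → ¬ (d S u ≡ 0)) → mis S * T0 ^ ∣ S ∣ ≤ Pot S
    bound-leaf v a sv dv va N[v]≡a da no-isolated =
      ≤[]-conclude (scale₂ (mis (S ∖ N[ v ])) (mis (S ∖ N[ a ])) (mis-leaf S v a sv N[v]≡a))
        (≤[]-+ (branch N[ v ] 1 F2 1 (N[]-⊆ v ∅ S) (trans (∣N[]∣ S v sv) (cong suc dv))
                       (heavy-F2 _ (N[]-⊆ v ∅ S) no-isolated) (∂-bound v sv dv))
               (branch N[ a ] 2 F2 2 (N[]-⊆ a ∅ S) (trans (∣N[]∣ S a sa) (cong suc da))
                       (heavy-F2 _ (N[]-⊆ a ∅ S) no-isolated) (∂-bound a sa da)))
        (num≤ _ _) (num≤ 1 _)
      where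
      sa = ∧-fst va
      ∂-bound : ∀ w → T (S w) → ∀ {e} → d S w ≡ e → ∣ ∂ S N[ w ] ∣ ≤ e
      ∂-bound w sw dw = ≤-trans (∣∂N[]∣ S w 1 sw (λ x wx → md x (∧-fst wx))) (≤-reflexive (trans (*-identityˡ _) dw))

    -- Every vertex has degree 2; v has neighbours a ≠ b, not adjacent since G is triangle-free.
    -- Branching on v, a, or b with a excluded costs 2 · 1.4143² / 1.406⁵ + 1.4143² / 1.406⁶ ≤ 1.
    bound-regular : ∀ v → T (S v) → (∀ u → T (S u) → d S u ≡ 2) → mis S * T0 ^ ∣ S ∣ ≤ Pot S
    bound-regular v sv all-2 with ∣∣≡2 (N S v) (all-2 v sv)
    ... | a , b , a≢b , va , vb , N[v]≡ab =
      ≤[]-conclude (scale₃ (mis (S ∖ N[ v ])) (mis (S ∖ N[ a ])) (mis (S ∖ (N[ b ]∪ ⁅ a ⁆ within S)))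
                             (mis-pair S v a b sv N[v]≡ab))
        (≤[]-+ (branch N[ v ] 2 F2 2 (N[]-⊆ v ∅ S) (trans (∣N[]∣ S v sv) (cong suc (all-2 v sv)))
                       (heavy-F2 _ (N[]-⊆ v ∅ S) no-isolated) (∂-bound v sv))
        (≤[]-+ (branch N[ a ] 2 F2 2 (N[]-⊆ a ∅ S) (trans (∣N[]∣ S a sa) (cong suc (all-2 a sa)))
                       (heavy-F2 _ (N[]-⊆ a ∅ S) no-isolated) (∂-bound a sa))
               (branch (N[ b ]∪ ⁅ a ⁆ within S) 3 F2 2 (N[]-⊆ b ⁅ a ⁆ S)
                       (trans (∣N[]∪⁅⁆∣ S b a sb sa a≢b ¬ba) (cong (λ z → suc (suc z)) (all-2 b sb)))
                       (heavy-F2 _ (N[]-⊆ b ⁅ a ⁆ S) no-isolated) (∣∂N[]∪⁅⁆∣ S v a b md sv va vb N[v]≡ab))))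
        (num≤ _ _) (num≤ 1 _)
      where
      sa = ∧-fst va
      sb = ∧-fst vb
      ¬ba : ¬ T (adj G b a)
      ¬ba ba = triangle-free a v b (adj-sym v a (∧-snd {S a} va)) (∧-snd {S b} vb) (adj-sym b a ba)
      no-isolated : ∀ u → T (S u) → ¬ (d S u ≡ 0)
      no-isolated u su e = 1+n≢0 (trans (sym (all-2 u su)) e)
      ∂-bound : ∀ w → T (S w) → ∣ ∂ S N[ w ] ∣ ≤ 2
      ∂-bound w sw = ≤-trans (∣∂N[]∣ S w 1 sw (λ x wx → md x (∧-fst wx))) (≤-reflexive (trans (*-identityˡ _) (all-2 w sw)))

    -- A vertex of minimum degree decides the case.
    bound-step : mis S * T0 ^ ∣ S ∣ ≤ Pot S
    bound-step with shape S md
    ... | empty ∣S∣≡0 = bound-empty S ∣S∣≡0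
    ... | isolated v sv d≡0 = bound-isolated v sv d≡0
    ... | regular v sv all-2 = bound-regular v sv all-2
    ... | leaf v sv dv no-isolated with ∣∣≡1 (N S v) dv
    ...   | a , va , N[v]≡a with degree-1-or-2 (d S a) (md a (∧-fst va)) (no-isolated a (∧-fst va))
    ...     | inj₁ da = bound-edge v a sv dv va N[v]≡a da
    ...     | inj₂ da = bound-leaf v a sv dv va N[v]≡a da no-isolated

  bound : ∀ k → Bound k
  bound zero S S≤0 md = bound-empty S (n≤0⇒n≡0 S≤0)
  bound (suc k) S S≤ md = Step.bound-step k (bound k) S S≤ md

findᵇ-just : ∀ {A : Set} (p : A → Bool) xs {z} → findᵇ p xs ≡ just z → T (p z)
findᵇ-just p (x ∷ xs) e with p x in px
... | true with refl ← e = ≡true⇒T px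
... | false = findᵇ-just p xs e

findᵇ-succeeds : ∀ {A : Set} (p : A → Bool) xs y → y ∈ xs → T (p y) → ¬ (findᵇ p xs ≡ nothing)
findᵇ-succeeds p (x ∷ xs) y y∈ py e with p x in px
findᵇ-succeeds p (x ∷ xs) y y∈ py () | true
findᵇ-succeeds p (x ∷ xs) y (here refl) py e | false = subst T px py
findᵇ-succeeds p (x ∷ xs) y (there y∈) py e | false = findᵇ-succeeds p xs y y∈ py e

maxOn : ∀ {n} → VSet n → (Fin n → ℕ) → List (Fin n) → ℕ
maxOn X f xs = foldr (λ x m → if X x then f x ⊔ m else m) 0 xs

maxOn-upper : ∀ {n} (X : VSet n) f xs x → x ∈ xs → T (X x) → f x ≤ maxOn X f xs
maxOn-upper X f (y ∷ xs) x (here refl) xx with X x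
... | true = m≤m⊔n (f x) _
maxOn-upper X f (y ∷ xs) x (there x∈) xx with X y
... | true = ≤-trans (maxOn-upper X f xs x x∈ xx) (m≤n⊔m (f y) _)
... | false = maxOn-upper X f xs x x∈ xx

maxOn-attained : ∀ {n} (X : VSet n) f xs → (maxOn X f xs ≡ 0) ⊎ Σ (Fin n) λ y → T (X y) × (f y ≡ maxOn X f xs)
maxOn-attained X f [] = inj₁ refl
maxOn-attained X f (x ∷ xs) with X x in xx
... | false = maxOn-attained X f xs
... | true with ≤-total (maxOn X f xs) (f x)
...   | inj₁ rest≤fx = inj₂ (x , ≡true⇒T xx , sym (m≥n⇒m⊔n≡m rest≤fx))
...   | inj₂ fx≤rest with maxOn-attained X f xs
...     | inj₁ rest≡0 = inj₁ (trans (m≤n⇒m⊔n≡n fx≤rest) rest≡0)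
...     | inj₂ (y , xy , fy) = inj₂ (y , xy , trans fy (sym (m≤n⇒m⊔n≡n fx≤rest)))

module Process {n : ℕ} (G : Graph n) (π : Permutation′ n) (I : VSet n) where
  open Neighbourhoods G
  open Potential G

  maximiser : ∀ X v → T (X v) → Σ (Fin n) λ y → T (X y ∧ (deg G X y ≡ᵇ maxDeg G X))
  maximiser X v xv with maxOn-attained X (deg G X) (allFin n)
  ... | inj₂ (y , xy , e) = y , ∧-intro xy (≡⇒≡ᵇ _ _ e)
  ... | inj₁ max≡0 = v , ∧-intro xv (≡⇒≡ᵇ _ _ (trans dv≡0 (sym max≡0)))
    where
    dv≡0 = n≤0⇒n≡0 (≤-trans (maxOn-upper X (deg G X) (allFin n) v (∈-allFin v) xv) (≤-reflexive max≡0))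

  choice-succeeds : ∀ X v → T (X v) → ¬ (chooseVertex π G X ≡ nothing)
  choice-succeeds X v xv with maximiser X v xv
  ... | y , t = findᵇ-succeeds _ (map (π ⟨$⟩ˡ_) (allFin n)) y in-order t
    where
    in-order : y ∈ map (π ⟨$⟩ˡ_) (allFin n)
    in-order = subst (_∈ map (π ⟨$⟩ˡ_) (allFin n)) (inverseˡ π) (∈-map⁺ (π ⟨$⟩ˡ_) (∈-allFin (π ⟨$⟩ʳ y)))

  -- each step that does not terminate removes the chosen vertex, so fuel |X| suffices
  run-terminates : ∀ k X → ∣ X ∣ ≤ k → T (maxDeg≤2ᵇ G (run k π G I X))
  run-terminates zero X X≤0 = all-intro _ (λ x → ∨-inl (not-intro (∣∣-empty X (n≤0⇒n≡0 X≤0) x)))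
  run-terminates (suc k) X X≤ with maxDeg≤2ᵇ G X in stop
  ... | true = ≡true⇒T stop
  ... | false with chooseVertex π G X in chosen
  ...   | nothing = ⊥-elim (choice-succeeds X v xv chosen)
    where
    nonempty : Σ (Fin n) λ v → T (X v)
    nonempty = ∣∣-nonempty X (λ e → subst T stop (all-intro _ (λ x → ∨-inl (not-intro (∣∣-empty X e x)))))
    v = proj₁ nonempty
    xv = proj₂ nonempty
  ...   | just x = run-terminates k _ (≤-pred (≤-trans (s≤s (∣∣-mono removed)) (≤-trans (≤-reflexive (sym (∣∣-remove X xx))) X≤)))
    where
    xx : T (X x)
    xx = ∧-fst (findᵇ-just _ (map (π ⟨$⟩ˡ_) (allFin n)) chosen)
    removed : (λ y → X y ∧ not (⁅ y ⁆ x) ∧ not (I x ∧ adj G x y)) ⊆ (X ∖ ⁅ x ⁆)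
    removed y t = ∧-intro (∧-fst t) (not-intro λ e →
      not-elim (∧-fst {not (⁅ y ⁆ x)} (∧-snd {X y} t)) (subst (λ z → T (⁅ y ⁆ z)) (⁅⁆-elim {x = x} {y} e) (⁅⁆-self y)))

  X* : VSet n
  X* = Xstar π G I

  X*-MaxDeg2 : MaxDeg2 X*
  X*-MaxDeg2 u xu = ≤-trans (≤-reflexive (sym (card≡∣∣ (N X* u))))
                            (≤ᵇ⇒≤ _ _ (⇒-elim (all-elim _ (run-terminates n (λ _ → true) (∣∣≤n _)) u) xu))

module Remainder {n : ℕ} (G : Graph n) (π : Permutation′ n) (I : VSet n) where
  open Neighbourhoods G
  open Potential G
  open Process G π I

  R : VSet n
  R = VR π G I

  endpoint-intro : ∀ u w → T (X* u) → T (X* w) → T (adj G u w) → d X* u ≡ 1 → d X* w ≡ 1 → T (VM π G I u)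
  endpoint-intro u w xu xw uw du dw = ∧-intro xu (any-intro _ w (∧-intro xw (∧-intro uw
    (∧-intro (≡⇒≡ᵇ _ _ (trans (card≡∣∣ (N X* u)) du)) (≡⇒≡ᵇ _ _ (trans (card≡∣∣ (N X* w)) dw))))))

  endpoint-elim : ∀ u → T (VM π G I u) →
    Σ (Fin n) λ w → T (X* w) × T (adj G u w) × (d X* u ≡ 1) × (d X* w ≡ 1)
  endpoint-elim u t with any-elim _ (∧-snd {X* u} t)
  ... | w , tw = w , ∧-fst tw , ∧-fst uw-rest ,
                 trans (sym (card≡∣∣ (N X* u))) (≡ᵇ⇒≡ _ _ (∧-fst degrees)) ,
                 trans (sym (card≡∣∣ (N X* w))) (≡ᵇ⇒≡ _ _ (∧-snd {deg G X* u ≡ᵇ 1} degrees))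
    where
    uw-rest = ∧-snd {X* w} tw
    degrees = ∧-snd {adj G u w} uw-rest

  -- a neighbour w of u ∈ R in X* is not an endpoint of an isolated edge, since its
  -- unique neighbour would be u, making u one too
  R-degree : ∀ u → T (R u) → d R u ≡ d X* u
  R-degree u ru = ∣∣-cong (λ w → T-ext _ _ (to w) (from w))
    where
    xu = ∧-fst ru
    to : ∀ w → T (N R u w) → T (N X* u w)
    to w t = ∧-intro (∧-fst (∧-fst t)) (∧-snd {R w} t)
    from : ∀ w → T (N X* u w) → T (N R u w)
    from w t = ∧-intro (∧-intro xw (not-intro w∉M)) uw
      where
      xw = ∧-fst t
      uw = ∧-snd {X* w} t
      w∉M : ¬ T (VM π G I w)
      w∉M m with endpoint-elim w m
      ... | z , xz , wz , dw , dz with ∣∣≡1 (N X* w) dw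
      ...   | _ , _ , only = not-elim (∧-snd {X* u} ru)
              (endpoint-intro u w xu xw uw (trans (cong (d X*) (trans (only u (∧-intro xu (adj-sym u w uw))) (sym (only z (∧-intro xz wz))))) dz) dw)

  R-MaxDeg2 : MaxDeg2 R
  R-MaxDeg2 u ru = ≤-trans (≤-reflexive (R-degree u ru)) (X*-MaxDeg2 u (∧-fst ru))

  R-leaf-neighbour : ∀ u w → T (R u) → d R u ≡ 1 → T (N R u w) → d R w ≡ 2
  R-leaf-neighbour u w ru du uw with d R w in dw | R-MaxDeg2 w (∧-fst uw)
  ... | 0 | _ = ⊥-elim (∣∣-empty (N R w) dw u (∧-intro ru (adj-sym u w (∧-snd {R w} uw))))
  ... | 1 | _ = ⊥-elim (not-elim (∧-snd {X* u} ru)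
                  (endpoint-intro u w (∧-fst ru) (∧-fst (∧-fst uw)) (∧-snd {R w} uw)
                    (trans (sym (R-degree u ru)) du) (trans (sym (R-degree w (∧-fst uw))) dw)))
  ... | 2 | _ = refl
  ... | suc (suc (suc _)) | s≤s (s≤s ())

  R-deg : ℕ → VSet n
  R-deg j u = R u ∧ (d R u ≡ᵇ j)

  -- each degree-2 vertex is the neighbour of at most two leaves
  R-leaves : ∣ R-deg 1 ∣ ≤ 2 * ∣ R-deg 2 ∣
  R-leaves = double-counting (R-deg 1) (R-deg 2) (N R) 2 hangs (λ w t → R-MaxDeg2 w (∧-fst t))
    where
    hangs : ∀ u → T (R-deg 1 u) → Σ (Fin n) λ w → T (R-deg 2 w) × T (N R w u)
    hangs u t with ∣∣≡1 (N R u) (≡ᵇ⇒≡ _ _ (∧-snd {R u} t))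
    ... | w , uw , _ = w , ∧-intro (∧-fst uw) (≡⇒≡ᵇ _ _ (R-leaf-neighbour u w (∧-fst t) (≡ᵇ⇒≡ _ _ (∧-snd {R u} t)) uw)) ,
                       ∧-intro (∧-fst t) (adj-sym u w (∧-snd {R w} uw))

level-0 level-1 level-2 : ∀ {m} → VSet m → (Fin m → ℕ) → VSet m
level-0 S g i = S i ∧ (g i ≡ᵇ 0)
level-1 S g i = S i ∧ (g i ≡ᵇ 1)
level-2 S g i = S i ∧ (2 ≤ᵇ g i)

tail₀ tail₁ tail₂ : ∀ {m} → VSet (suc m) → (Fin (suc m) → ℕ) → ℕ
tail₀ S g = ∣ level-0 (λ i → S (suc i)) (λ i → g (suc i)) ∣
tail₁ S g = ∣ level-1 (λ i → S (suc i)) (λ i → g (suc i)) ∣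
tail₂ S g = ∣ level-2 (λ i → S (suc i)) (λ i → g (suc i)) ∣

prodFin-level : ∀ m x₀ x₁ x₂ (S : VSet m) (g : Fin m → ℕ) →
  prodFin m (λ i → if S i then level x₀ x₁ x₂ (g i) else 1)
  ≡ x₀ ^ ∣ level-0 S g ∣ * x₁ ^ ∣ level-1 S g ∣ * x₂ ^ ∣ level-2 S g ∣
prodFin-level zero x₀ x₁ x₂ S g = refl
prodFin-level (suc m) x₀ x₁ x₂ S g with S zero | g zero | prodFin-level m x₀ x₁ x₂ (λ i → S (suc i)) (λ i → g (suc i))
... | false | _ | rest = trans (*-identityˡ _) rest
... | true | 0 | rest = trans (cong (x₀ *_) rest) (regroup₀ x₀ (x₀ ^ tail₀ S g) (x₁ ^ tail₁ S g) (x₂ ^ tail₂ S g))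
  where
  regroup₀ : ∀ x a b c → x * (a * b * c) ≡ x * a * b * c
  regroup₀ = solve-∀
... | true | 1 | rest = trans (cong (x₁ *_) rest) (regroup₁ x₁ (x₀ ^ tail₀ S g) (x₁ ^ tail₁ S g) (x₂ ^ tail₂ S g))
  where
  regroup₁ : ∀ x a b c → x * (a * b * c) ≡ a * (x * b) * c
  regroup₁ = solve-∀
... | true | suc (suc _) | rest = trans (cong (x₂ *_) rest) (regroup₂ x₂ (x₀ ^ tail₀ S g) (x₁ ^ tail₁ S g) (x₂ ^ tail₂ S g))
  where
  regroup₂ : ∀ x a b c → x * (a * b * c) ≡ a * b * (x * c)
  regroup₂ = solve-∀

∣∣-level : ∀ {m} (S : VSet m) (g : Fin m → ℕ) → ∣ S ∣ ≡ ∣ level-0 S g ∣ + ∣ level-1 S g ∣ + ∣ level-2 S g ∣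
∣∣-level {zero} S g = refl
∣∣-level {suc m} S g with S zero | g zero | ∣∣-level (λ i → S (suc i)) (λ i → g (suc i))
... | false | _ | rest = rest
... | true | 0 | rest = cong suc rest
... | true | 1 | rest = trans (cong suc rest) (cong (_+ ∣ level-2 S′ g′ ∣) (sym (+-suc ∣ level-0 S′ g′ ∣ ∣ level-1 S′ g′ ∣)))
  where
  S′ = λ i → S (suc i)
  g′ = λ i → g (suc i)
... | true | suc (suc _) | rest = trans (cong suc rest) (sym (+-suc _ _))

^-distribʳ-* : ∀ a b k → (a * b) ^ k ≡ a ^ k * b ^ k
^-distribʳ-* a b zero = refl
^-distribʳ-* a b (suc k) = trans (cong (a * b *_) (^-distribʳ-* a b k)) (regroup a b (a ^ k) (b ^ k))
  where
  regroup : ∀ a b x y → a * b * (x * y) ≡ a * x * (b * y)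
  regroup = solve-∀

^-comm : ∀ a c j → (a ^ c) ^ j ≡ (a ^ j) ^ c
^-comm a c j = trans (^-*-assoc a c j) (trans (cong (a ^_) (*-comm c j)) (sym (^-*-assoc a j c)))

^-positive : ∀ a k → 0 < a → 0 < a ^ k
^-positive a zero _ = s≤s z≤n
^-positive a (suc k) a>0 = *-mono-≤ a>0 (^-positive a k a>0)

-- α^c₁ β^c₂ ≤ t^(c₁ + c₂) when c₁ ≤ 2c₂, t ≤ α and α²β ≤ t³: padding with
-- e = 2c₂ - c₁ factors t ≤ α gives at most (α²β)^c₂ ≤ t^(3c₂) = t^(c₁ + c₂ + e).
mixed-power : ∀ α β t c₁ c₂ → 0 < t → c₁ ≤ 2 * c₂ → t ≤ α → α ^ 2 * β ≤ t ^ 3 →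
  α ^ c₁ * β ^ c₂ ≤ t ^ (c₁ + c₂)
mixed-power α β t c₁ c₂ t>0 c₁≤ t≤α α²β≤t³ = cancelʳ _ _ (t ^ e) (^-positive t e t>0) (begin
  α ^ c₁ * β ^ c₂ * t ^ e       ≤⟨ *-monoʳ-≤ (α ^ c₁ * β ^ c₂) (^-monoˡ-≤ e t≤α) ⟩
  α ^ c₁ * β ^ c₂ * α ^ e       ≡⟨ swap (α ^ c₁) (β ^ c₂) (α ^ e) ⟩
  α ^ c₁ * α ^ e * β ^ c₂       ≡⟨ cong (_* β ^ c₂) (trans (sym (^-distribˡ-+-* α c₁ e)) (cong (α ^_) c₁+e≡)) ⟩
  α ^ (2 * c₂) * β ^ c₂         ≡⟨ cong (_* β ^ c₂) (sym (^-*-assoc α 2 c₂)) ⟩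
  (α ^ 2) ^ c₂ * β ^ c₂         ≡⟨ ^-distribʳ-* (α ^ 2) β c₂ ⟨
  (α ^ 2 * β) ^ c₂              ≤⟨ ^-monoˡ-≤ c₂ α²β≤t³ ⟩
  (t ^ 3) ^ c₂                  ≡⟨ ^-*-assoc t 3 c₂ ⟩
  t ^ (3 * c₂)                  ≡⟨ cong (t ^_) exponent ⟩
  t ^ (c₁ + c₂ + e)             ≡⟨ ^-distribˡ-+-* t (c₁ + c₂) e ⟩
  t ^ (c₁ + c₂) * t ^ e         ∎)
  where
  open ≤-Reasoning
  e = 2 * c₂ ∸ c₁
  c₁+e≡ : c₁ + e ≡ 2 * c₂
  c₁+e≡ = m+[n∸m]≡n c₁≤
  swap : ∀ x y z → x * y * z ≡ x * z * y
  swap = solve-∀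
  exponent : 3 * c₂ ≡ c₁ + c₂ + e
  exponent = trans (three c₂) (trans (cong (_+ c₂) (sym c₁+e≡)) (shuffle c₁ c₂ e))
    where
    three : ∀ c → 3 * c ≡ 2 * c + c
    three = solve-∀
    shuffle : ∀ a b c → a + c + b ≡ a + b + c
    shuffle = solve-∀

fourth-power-bound : ∀ x c₀ c₁ c₂ → c₁ ≤ 2 * c₂ → x * T0 ^ (c₀ + c₁ + c₂) ≤ T0 ^ c₀ * F1 ^ c₁ * F2 ^ c₂ →
  x ^ 4 * 10000 ^ (c₀ + c₁ + c₂) ≤ 39741 ^ (c₀ + c₁ + c₂)
fourth-power-bound x c₀ c₁ c₂ c₁≤ h = cancelʳ _ _ ((T0 ^ 3) ^ total) (^-positive _ total (num≤ 1 _)) (begin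
  x ^ 4 * 10000 ^ total * (T0 ^ 3) ^ total          ≡⟨ *-assoc (x ^ 4) _ _ ⟩
  x ^ 4 * (10000 ^ total * (T0 ^ 3) ^ total)        ≡⟨ cong (x ^ 4 *_) (trans (sym (^-distribʳ-* 10000 (T0 ^ 3) total)) (^-comm T0 4 total)) ⟩
  x ^ 4 * (T0 ^ total) ^ 4                      ≡⟨ ^-distribʳ-* x (T0 ^ total) 4 ⟨
  (x * T0 ^ total) ^ 4                          ≤⟨ ^-monoˡ-≤ 4 h ⟩
  (T0 ^ c₀ * F1 ^ c₁ * F2 ^ c₂) ^ 4         ≡⟨ trans (^-distribʳ-* (T0 ^ c₀ * F1 ^ c₁) (F2 ^ c₂) 4)
                                                     (cong (_* (F2 ^ c₂) ^ 4) (^-distribʳ-* (T0 ^ c₀) (F1 ^ c₁) 4)) ⟩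
  (T0 ^ c₀) ^ 4 * (F1 ^ c₁) ^ 4 * (F2 ^ c₂) ^ 4
                                            ≡⟨ cong₂ _*_ (cong₂ _*_ (^-comm T0 c₀ 4) (^-comm F1 c₁ 4)) (^-comm F2 c₂ 4) ⟩
  τ ^ c₀ * α ^ c₁ * β ^ c₂                  ≡⟨ *-assoc (τ ^ c₀) _ _ ⟩
  τ ^ c₀ * (α ^ c₁ * β ^ c₂)                ≤⟨ *-mono-≤ (^-monoˡ-≤ c₀ (num≤ τ t)) (mixed-power α β t c₁ c₂ (num≤ 1 t) c₁≤ (num≤ t α) (num≤ _ _)) ⟩
  t ^ c₀ * t ^ (c₁ + c₂)                    ≡⟨ trans (sym (^-distribˡ-+-* t c₀ (c₁ + c₂))) (cong (t ^_) (sym (+-assoc c₀ c₁ c₂))) ⟩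
  t ^ total                                     ≡⟨ ^-distribʳ-* 39741 (T0 ^ 3) total ⟩
  39741 ^ total * (T0 ^ 3) ^ total                  ∎)
  where
  open ≤-Reasoning
  total = c₀ + c₁ + c₂
  τ α β t : ℕ
  τ = T0 ^ 4
  α = F1 ^ 4
  β = F2 ^ 4
  t = 39741 * T0 ^ 3

misR-bound : ∀ {n} (G : Graph n) (π : Permutation′ n) → TriangleFree G → (I : VSet n) →
  misR π G I ^ 4 * 10000 ^ r π G I ≤ 39741 ^ r π G I
misR-bound {n} G π triangle-free I =
  subst (λ z → mis R ^ 4 * 10000 ^ z ≤ 39741 ^ z) (sym (trans (card≡∣∣ R) size))
        (fourth-power-bound (mis R) c₀ c₁ c₂ leaves measure)
  where
  open Neighbourhoods G
  open Potential G
  open Remainder G π I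
  open MeasureBound G triangle-free
  c₀ c₁ c₂ : ℕ
  c₀ = ∣ level-0 R (d R) ∣
  c₁ = ∣ level-1 R (d R) ∣
  c₂ = ∣ level-2 R (d R) ∣
  size : ∣ R ∣ ≡ c₀ + c₁ + c₂
  size = ∣∣-level R (d R)
  measure : mis R * T0 ^ (c₀ + c₁ + c₂) ≤ T0 ^ c₀ * F1 ^ c₁ * F2 ^ c₂
  measure = subst (λ z → mis R * T0 ^ z ≤ T0 ^ c₀ * F1 ^ c₁ * F2 ^ c₂) size
              (≤-trans (bound n R (∣∣≤n R) R-MaxDeg2) (≤-reflexive (prodFin-level n T0 F1 F2 R (d R))))
  leaves : c₁ ≤ 2 * c₂
  leaves = ≤-trans R-leaves (*-monoʳ-≤ 2 (∣∣-mono degree-2))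
    where
    degree-2 : R-deg 2 ⊆ level-2 R (d R)
    degree-2 u t = ∧-intro {R u} {2 ≤ᵇ d R u} (∧-fst t) (≤⇒≤ᵇ (≤-reflexive (sym (≡ᵇ⇒≡ (d R u) 2 (∧-snd {R u} t)))))

lemma3p5 : (n : ℕ) (G : Graph n) (π : Permutation′ n) → TriangleFree G →
    (I : VSet n) → MaximalIndependent G I →
    (q : ℚ) → q ℚ.+ 1ℚ ℚ.< q ^ℚ 3 →
    (ℤ.+ misR π G I ℚ./ 1) ^ℚ 4 ℚ.≤ ((ℤ.+ 3 ℚ./ 1) ℚ.* q) ^ℚ r π G I
lemma3p5 n G π triangle-free I _ q q+1<q³ =
  rational-bound (misR π G I) (r π G I) q (misR-bound G π triangle-free I) q+1<q³
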